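{- Let $B\in\{1,2,3,4,6,7,8,9\}$ (i.e. $B\in\{1,\dots,9\}$, $B\neq 5$). Let $p\neq q$ be coprime positive integers satisfying $$B\,q^{3}-\frac{q^{3}}{3600^{3}}\leqslant p\leqslant B\,q^{3}+\frac{q^{3}}{3600^{3}}.$$ Then the tenth degree cuboid characteristic equation $Q_{pq}(t)=0$ produces no perfect cuboids, i.e. there is no positive integer $t$ such that the triple $(p,q,t)$ produces a perfect cuboid.
   Context: For integers $p,q$ the polynomial $Q_{pq}(t)\in\mathbb Z[t]$ is $$Q_{pq}(t)=t^{10}+(2q^{2}+p^{2})(3q^{2}-2p^{2})\,t^{8}+(q^{8}+10p^{2}q^{6}+4p^{4}q^{4}-14p^{6}q^{2}+p^{8})\,t^{6}-p^{2}q^{2}(q^{8}-14p^{2}q^{6}+4p^{4}q^{4}+10p^{6}q^{2}+p^{8})\,t^{4}-p^{6}q^{6}(q^{2}+2p^{2})(3p^{2}-2q^{2})\,t^{2}-q^{10}p^{10}.$$ A triple of positive integers $(p,q,t)$ with $p\neq q$ coprime is said to produce a perfect cuboid (a rectangular box with integer edges, integer face diagonals and integer space diagonal) exactly when $Q_{pq}(t)=0$ and $t>p^{2}$, $t>pq$, $t>q^{2}$, $(p^{2}+t)(pq+t)>2t^{2}$. -}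

module Defs where

open import Data.Nat as ℕ using (ℕ; _≤_; _<_)
open import Data.Nat.Coprimality using (Coprime)
open import Data.Integer as ℤ using (ℤ; +_; _-_)
open import Data.Product using (_×_)
open import Relation.Binary.PropositionalEquality using (_≡_; _≢_)
open import Relation.Nullary using (¬_)

infixr 8 _^ᶻ_
_^ᶻ_ : ℤ → ℕ → ℤ
x ^ᶻ ℕ.zero = + 1
x ^ᶻ ℕ.suc n = x ℤ.* (x ^ᶻ n)

Q : ℤ → ℤ → ℤ → ℤ
Q p q t =
  t ^ᶻ 10
  ℤ.+ ((+ 2 ℤ.* q ^ᶻ 2 ℤ.+ p ^ᶻ 2) ℤ.* (+ 3 ℤ.* q ^ᶻ 2 - + 2 ℤ.* p ^ᶻ 2)) ℤ.* t ^ᶻ 8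
  ℤ.+ (q ^ᶻ 8 ℤ.+ + 10 ℤ.* p ^ᶻ 2 ℤ.* q ^ᶻ 6 ℤ.+ + 4 ℤ.* p ^ᶻ 4 ℤ.* q ^ᶻ 4
        - + 14 ℤ.* p ^ᶻ 6 ℤ.* q ^ᶻ 2 ℤ.+ p ^ᶻ 8) ℤ.* t ^ᶻ 6
  - p ^ᶻ 2 ℤ.* q ^ᶻ 2 ℤ.* (q ^ᶻ 8 - + 14 ℤ.* p ^ᶻ 2 ℤ.* q ^ᶻ 6 ℤ.+ + 4 ℤ.* p ^ᶻ 4 ℤ.* q ^ᶻ 4
        ℤ.+ + 10 ℤ.* p ^ᶻ 6 ℤ.* q ^ᶻ 2 ℤ.+ p ^ᶻ 8) ℤ.* t ^ᶻ 4
  - p ^ᶻ 6 ℤ.* q ^ᶻ 6 ℤ.* (q ^ᶻ 2 ℤ.+ + 2 ℤ.* p ^ᶻ 2) ℤ.* (+ 3 ℤ.* p ^ᶻ 2 - + 2 ℤ.* q ^ᶻ 2) ℤ.* t ^ᶻ 2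
  - q ^ᶻ 10 ℤ.* p ^ᶻ 10

ProducesPerfectCuboid : ℕ → ℕ → ℕ → Set
ProducesPerfectCuboid p q t =
  0 < p × 0 < q × 0 < t × p ≢ q × Coprime p q ×
  Q (+ p) (+ q) (+ t) ≡ + 0 ×
  p ℕ.^ 2 < t × p ℕ.* q < t × q ℕ.^ 2 < t ×
  2 ℕ.* t ℕ.^ 2 < (p ℕ.^ 2 ℕ.+ t) ℕ.* (p ℕ.* q ℕ.+ t)

{-# OPTIONS --safe #-}
module Submission where

-- Write N = p² + 2pq − 2q². When q ≥ 3600 the hypothesis on p forces q³ ≤ 2p, and in this regime
-- Q(p, q, τ) is dominated by one explicit term for τ near N:
--   Q(p, q, N − n) < 0                                          for 1 ≤ n ≤ 2pq,
--   |Q(p, q, N + m) − 16p¹⁶q(pm − 5q³)| < 16·255 p¹⁶q²          for m ≤ 11,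
--   |Q(p, q, N + 5) − 80p¹⁵q(p + 10q)(p − q³ + 4q)| < 80p¹⁶q.
-- The cuboid conditions put t in (p², N + 11], so a root t = N + m has |pm − 5q³| < 255q; as
-- p ≈ Bq³ this gives mB = 5, hence m = 5, and then p + 4q = q³, so q ∣ p, contradicting
-- coprimality. When q < 3600 the hypothesis forces p = Bq³, so q = 1 and p = B, and the
-- cuboid conditions leave finitely many t to check.
-- Each bound is certified by computation: the difference is normalised to its monomials
-- c pⁱ qʲ xᵏ, and each monomial is compared with the lead monomial using q ≥ 3600 and q³ ≤ 2p.

open import Data.Empty using (⊥)
open import Data.Fin using (Fin; toℕ; fromℕ<)
import Data.Fin.Properties as Fin
open import Data.Integer as ℤ using (ℤ; +_; -[1+_]; 0ℤ; 1ℤ)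
import Data.Integer.Properties as ℤ
open import Data.Integer.Tactic.RingSolver using (solve-∀)
open import Data.List using (List; []; _∷_; _++_; map)
open import Data.List.Relation.Unary.All using (All; []; _∷_; all?)
open import Data.Nat using (ℕ; zero; suc; _≤_; _<_; _*_; _+_; _∸_; _^_; ∣_-_∣; _⊓_; z≤n; s≤s;
  NonZero; >-nonZero; _≤?_; _≟_)
open import Data.Nat.Coprimality using (Coprime)
open import Data.Nat.Divisibility using (_∣_; divides; ∣m+n∣m⇒∣n; m∣m*n; n∣m*n; ∣-refl)
open import Data.Nat.Primality using (prime?; prime⇒irreducible)
import Data.Nat.Properties as ℕ
import Data.Nat.Tactic.RingSolver as ℕ-Solver
open import Data.Product using (_×_; _,_; proj₁; proj₂)
open import Data.Sum using (_⊎_; inj₁; inj₂; [_,_]′)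
open import Data.Vec as Vec using (Vec; []; _∷_; lookup)
open import Relation.Binary.PropositionalEquality
  using (_≡_; _≢_; refl; sym; trans; cong; cong₂; subst; subst₂; module ≡-Reasoning)
open import Relation.Nullary using (¬_; Dec; yes; no; ¬?; _×-dec_; _⊎-dec_; contradiction)
open import Relation.Nullary.Decidable using (toWitness)

open import Defs

-- Polynomial expressions and normal forms

infixl 6 _⊕_ _⊖_
infixl 7 _⊗_
infixr 8 _⊛_

data Expr (n : ℕ) : Set where
  con : ℤ → Expr n
  var : Fin n → Expr n
  _⊕_ _⊖_ _⊗_ : Expr n → Expr n → Expr n
  _⊛_ : Expr n → ℕ → Expr n

⟦_⟧ : ∀ {n} → Expr n → Vec ℤ n → ℤ
⟦ con c ⟧ ρ = c
⟦ var i ⟧ ρ = lookup ρ i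
⟦ a ⊕ b ⟧ ρ = ⟦ a ⟧ ρ ℤ.+ ⟦ b ⟧ ρ
⟦ a ⊖ b ⟧ ρ = ⟦ a ⟧ ρ ℤ.- ⟦ b ⟧ ρ
⟦ a ⊗ b ⟧ ρ = ⟦ a ⟧ ρ ℤ.* ⟦ b ⟧ ρ
⟦ a ⊛ k ⟧ ρ = ⟦ a ⟧ ρ ^ᶻ k

-- Horner form: a polynomial in n + 1 variables is the list of its coefficients
-- (polynomials in the last n variables) with respect to the first one.
Poly : ℕ → Set
Poly zero = ℤ
Poly (suc n) = List (Poly n)

⟦_⟧ₚ : ∀ {n} → Poly n → Vec ℤ n → ℤ
horner : ∀ {n} → List (Poly n) → ℤ → Vec ℤ n → ℤ
⟦_⟧ₚ {zero} c [] = c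
⟦_⟧ₚ {suc n} cs (x ∷ ρ) = horner cs x ρ
horner [] x ρ = 0ℤ
horner (c ∷ cs) x ρ = ⟦ c ⟧ₚ ρ ℤ.+ x ℤ.* horner cs x ρ

0ₚ : ∀ {n} → Poly n
0ₚ {zero} = 0ℤ
0ₚ {suc n} = []

constₚ : ∀ {n} → ℤ → Poly n
constₚ {zero} c = c
constₚ {suc n} c = constₚ c ∷ []

varₚ : ∀ {n} → Fin n → Poly n
varₚ {suc n} Fin.zero = 0ₚ ∷ constₚ 1ℤ ∷ []
varₚ {suc n} (Fin.suc i) = varₚ i ∷ []

infixl 6 _+ₚ_ _+ₗ_
infixl 7 _*ₚ_ _*ₗ_ _·ₗ_

_+ₚ_ : ∀ {n} → Poly n → Poly n → Poly n
_+ₗ_ : ∀ {n} → List (Poly n) → List (Poly n) → List (Poly n)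
_+ₚ_ {zero} a b = a ℤ.+ b
_+ₚ_ {suc n} as bs = as +ₗ bs
[] +ₗ bs = bs
(a ∷ as) +ₗ [] = a ∷ as
(a ∷ as) +ₗ (b ∷ bs) = a +ₚ b ∷ as +ₗ bs

-ₚ_ : ∀ {n} → Poly n → Poly n
-ₚ_ {zero} a = ℤ.- a
-ₚ_ {suc n} as = map -ₚ_ as

_*ₚ_ : ∀ {n} → Poly n → Poly n → Poly n
_·ₗ_ : ∀ {n} → Poly n → List (Poly n) → List (Poly n)
_*ₗ_ : ∀ {n} → List (Poly n) → List (Poly n) → List (Poly n)
_*ₚ_ {zero} a b = a ℤ.* b
_*ₚ_ {suc n} as bs = as *ₗ bs
a ·ₗ [] = []
a ·ₗ (b ∷ bs) = a *ₚ b ∷ a ·ₗ bs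
[] *ₗ bs = []
(a ∷ as) *ₗ bs = a ·ₗ bs +ₗ (0ₚ ∷ as *ₗ bs)

_^ₚ_ : ∀ {n} → Poly n → ℕ → Poly n
a ^ₚ zero = constₚ 1ℤ
a ^ₚ suc k = a *ₚ a ^ₚ k

normalise : ∀ {n} → Expr n → Poly n
normalise (con c) = constₚ c
normalise (var i) = varₚ i
normalise (a ⊕ b) = normalise a +ₚ normalise b
normalise (a ⊖ b) = normalise a +ₚ -ₚ normalise b
normalise (a ⊗ b) = normalise a *ₚ normalise b
normalise (a ⊛ k) = normalise a ^ₚ k

0ₚ-homo : ∀ {n} (ρ : Vec ℤ n) → ⟦ 0ₚ {n} ⟧ₚ ρ ≡ 0ℤ
0ₚ-homo [] = refl
0ₚ-homo (x ∷ ρ) = refl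

constₚ-homo : ∀ {n} c (ρ : Vec ℤ n) → ⟦ constₚ c ⟧ₚ ρ ≡ c
constₚ-homo c [] = refl
constₚ-homo c (x ∷ ρ) = begin
  ⟦ constₚ c ⟧ₚ ρ ℤ.+ x ℤ.* 0ℤ ≡⟨ cong₂ ℤ._+_ (constₚ-homo c ρ) (ℤ.*-zeroʳ x) ⟩
  c ℤ.+ 0ℤ                     ≡⟨ ℤ.+-identityʳ c ⟩
  c                            ∎
  where open ≡-Reasoning

varₚ-homo : ∀ {n} (i : Fin n) ρ → ⟦ varₚ i ⟧ₚ ρ ≡ lookup ρ i
varₚ-homo Fin.zero (x ∷ ρ) = begin
  ⟦ 0ₚ ⟧ₚ ρ ℤ.+ x ℤ.* (⟦ constₚ 1ℤ ⟧ₚ ρ ℤ.+ x ℤ.* 0ℤ)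
    ≡⟨ cong₂ (λ u v → u ℤ.+ x ℤ.* (v ℤ.+ x ℤ.* 0ℤ)) (0ₚ-homo ρ) (constₚ-homo 1ℤ ρ) ⟩
  0ℤ ℤ.+ x ℤ.* (1ℤ ℤ.+ x ℤ.* 0ℤ)
    ≡⟨ lemma x ⟩
  x ∎
  where
  open ≡-Reasoning
  lemma : ∀ x → 0ℤ ℤ.+ x ℤ.* (1ℤ ℤ.+ x ℤ.* 0ℤ) ≡ x
  lemma = solve-∀
varₚ-homo (Fin.suc i) (x ∷ ρ) = begin
  ⟦ varₚ i ⟧ₚ ρ ℤ.+ x ℤ.* 0ℤ ≡⟨ cong₂ ℤ._+_ (varₚ-homo i ρ) (ℤ.*-zeroʳ x) ⟩
  lookup ρ i ℤ.+ 0ℤ          ≡⟨ ℤ.+-identityʳ _ ⟩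
  lookup ρ i                 ∎
  where open ≡-Reasoning

+ₚ-homo : ∀ {n} (a b : Poly n) ρ → ⟦ a +ₚ b ⟧ₚ ρ ≡ ⟦ a ⟧ₚ ρ ℤ.+ ⟦ b ⟧ₚ ρ
+ₗ-homo : ∀ {n} (as bs : List (Poly n)) x ρ → horner (as +ₗ bs) x ρ ≡ horner as x ρ ℤ.+ horner bs x ρ
+ₚ-homo {zero} a b [] = refl
+ₚ-homo {suc n} as bs (x ∷ ρ) = +ₗ-homo as bs x ρ
+ₗ-homo [] bs x ρ = sym (ℤ.+-identityˡ _)
+ₗ-homo (a ∷ as) [] x ρ = sym (ℤ.+-identityʳ _)
+ₗ-homo (a ∷ as) (b ∷ bs) x ρ = begin
  ⟦ a +ₚ b ⟧ₚ ρ ℤ.+ x ℤ.* horner (as +ₗ bs) x ρ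
    ≡⟨ cong₂ (λ u v → u ℤ.+ x ℤ.* v) (+ₚ-homo a b ρ) (+ₗ-homo as bs x ρ) ⟩
  (⟦ a ⟧ₚ ρ ℤ.+ ⟦ b ⟧ₚ ρ) ℤ.+ x ℤ.* (horner as x ρ ℤ.+ horner bs x ρ)
    ≡⟨ lemma (⟦ a ⟧ₚ ρ) (⟦ b ⟧ₚ ρ) (horner as x ρ) (horner bs x ρ) x ⟩
  (⟦ a ⟧ₚ ρ ℤ.+ x ℤ.* horner as x ρ) ℤ.+ (⟦ b ⟧ₚ ρ ℤ.+ x ℤ.* horner bs x ρ) ∎
  where
  open ≡-Reasoning
  lemma : ∀ a b c d x → (a ℤ.+ b) ℤ.+ x ℤ.* (c ℤ.+ d) ≡ (a ℤ.+ x ℤ.* c) ℤ.+ (b ℤ.+ x ℤ.* d)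
  lemma = solve-∀

-ₚ-homo : ∀ {n} (a : Poly n) ρ → ⟦ -ₚ a ⟧ₚ ρ ≡ ℤ.- ⟦ a ⟧ₚ ρ
-ₗ-homo : ∀ {n} (as : List (Poly n)) x ρ → horner (map -ₚ_ as) x ρ ≡ ℤ.- horner as x ρ
-ₚ-homo {zero} a [] = refl
-ₚ-homo {suc n} as (x ∷ ρ) = -ₗ-homo as x ρ
-ₗ-homo [] x ρ = refl
-ₗ-homo (a ∷ as) x ρ = begin
  ⟦ -ₚ a ⟧ₚ ρ ℤ.+ x ℤ.* horner (map -ₚ_ as) x ρ
    ≡⟨ cong₂ (λ u v → u ℤ.+ x ℤ.* v) (-ₚ-homo a ρ) (-ₗ-homo as x ρ) ⟩
  ℤ.- ⟦ a ⟧ₚ ρ ℤ.+ x ℤ.* ℤ.- horner as x ρ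
    ≡⟨ lemma (⟦ a ⟧ₚ ρ) (horner as x ρ) x ⟩
  ℤ.- (⟦ a ⟧ₚ ρ ℤ.+ x ℤ.* horner as x ρ) ∎
  where
  open ≡-Reasoning
  lemma : ∀ a c x → ℤ.- a ℤ.+ x ℤ.* ℤ.- c ≡ ℤ.- (a ℤ.+ x ℤ.* c)
  lemma = solve-∀

*ₚ-homo : ∀ {n} (a b : Poly n) ρ → ⟦ a *ₚ b ⟧ₚ ρ ≡ ⟦ a ⟧ₚ ρ ℤ.* ⟦ b ⟧ₚ ρ
·ₗ-homo : ∀ {n} (a : Poly n) bs x ρ → horner (a ·ₗ bs) x ρ ≡ ⟦ a ⟧ₚ ρ ℤ.* horner bs x ρ
*ₗ-homo : ∀ {n} (as bs : List (Poly n)) x ρ → horner (as *ₗ bs) x ρ ≡ horner as x ρ ℤ.* horner bs x ρ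
*ₚ-homo {zero} a b [] = refl
*ₚ-homo {suc n} as bs (x ∷ ρ) = *ₗ-homo as bs x ρ
·ₗ-homo a [] x ρ = sym (ℤ.*-zeroʳ (⟦ a ⟧ₚ ρ))
·ₗ-homo a (b ∷ bs) x ρ = begin
  ⟦ a *ₚ b ⟧ₚ ρ ℤ.+ x ℤ.* horner (a ·ₗ bs) x ρ
    ≡⟨ cong₂ (λ u v → u ℤ.+ x ℤ.* v) (*ₚ-homo a b ρ) (·ₗ-homo a bs x ρ) ⟩
  ⟦ a ⟧ₚ ρ ℤ.* ⟦ b ⟧ₚ ρ ℤ.+ x ℤ.* (⟦ a ⟧ₚ ρ ℤ.* horner bs x ρ)
    ≡⟨ lemma (⟦ a ⟧ₚ ρ) (⟦ b ⟧ₚ ρ) (horner bs x ρ) x ⟩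
  ⟦ a ⟧ₚ ρ ℤ.* (⟦ b ⟧ₚ ρ ℤ.+ x ℤ.* horner bs x ρ) ∎
  where
  open ≡-Reasoning
  lemma : ∀ a b c x → a ℤ.* b ℤ.+ x ℤ.* (a ℤ.* c) ≡ a ℤ.* (b ℤ.+ x ℤ.* c)
  lemma = solve-∀
*ₗ-homo [] bs x ρ = refl
*ₗ-homo (a ∷ as) bs x ρ = begin
  horner (a ·ₗ bs +ₗ (0ₚ ∷ as *ₗ bs)) x ρ
    ≡⟨ +ₗ-homo (a ·ₗ bs) (0ₚ ∷ as *ₗ bs) x ρ ⟩
  horner (a ·ₗ bs) x ρ ℤ.+ (⟦ 0ₚ ⟧ₚ ρ ℤ.+ x ℤ.* horner (as *ₗ bs) x ρ)
    ≡⟨ cong₂ (λ u v → u ℤ.+ (v ℤ.+ x ℤ.* horner (as *ₗ bs) x ρ)) (·ₗ-homo a bs x ρ) (0ₚ-homo ρ) ⟩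
  ⟦ a ⟧ₚ ρ ℤ.* horner bs x ρ ℤ.+ (0ℤ ℤ.+ x ℤ.* horner (as *ₗ bs) x ρ)
    ≡⟨ cong (λ v → ⟦ a ⟧ₚ ρ ℤ.* horner bs x ρ ℤ.+ (0ℤ ℤ.+ x ℤ.* v)) (*ₗ-homo as bs x ρ) ⟩
  ⟦ a ⟧ₚ ρ ℤ.* horner bs x ρ ℤ.+ (0ℤ ℤ.+ x ℤ.* (horner as x ρ ℤ.* horner bs x ρ))
    ≡⟨ lemma (⟦ a ⟧ₚ ρ) (horner bs x ρ) (horner as x ρ) x ⟩
  (⟦ a ⟧ₚ ρ ℤ.+ x ℤ.* horner as x ρ) ℤ.* horner bs x ρ ∎
  where
  open ≡-Reasoning
  lemma : ∀ a b c x → a ℤ.* b ℤ.+ (0ℤ ℤ.+ x ℤ.* (c ℤ.* b)) ≡ (a ℤ.+ x ℤ.* c) ℤ.* b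
  lemma = solve-∀

^ₚ-homo : ∀ {n} (a : Poly n) k ρ → ⟦ a ^ₚ k ⟧ₚ ρ ≡ ⟦ a ⟧ₚ ρ ^ᶻ k
^ₚ-homo a zero ρ = constₚ-homo 1ℤ ρ
^ₚ-homo a (suc k) ρ = trans (*ₚ-homo a (a ^ₚ k) ρ) (cong (⟦ a ⟧ₚ ρ ℤ.*_) (^ₚ-homo a k ρ))

normalise-correct : ∀ {n} (e : Expr n) ρ → ⟦ normalise e ⟧ₚ ρ ≡ ⟦ e ⟧ ρ
normalise-correct (con c) ρ = constₚ-homo c ρ
normalise-correct (var i) ρ = varₚ-homo i ρ
normalise-correct (a ⊕ b) ρ =
  trans (+ₚ-homo (normalise a) (normalise b) ρ) (cong₂ ℤ._+_ (normalise-correct a ρ) (normalise-correct b ρ))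
normalise-correct (a ⊖ b) ρ =
  trans (+ₚ-homo (normalise a) (-ₚ normalise b) ρ)
        (cong₂ ℤ._+_ (normalise-correct a ρ) (trans (-ₚ-homo (normalise b) ρ) (cong ℤ.-_ (normalise-correct b ρ))))
normalise-correct (a ⊗ b) ρ =
  trans (*ₚ-homo (normalise a) (normalise b) ρ) (cong₂ ℤ._*_ (normalise-correct a ρ) (normalise-correct b ρ))
normalise-correct (a ⊛ k) ρ =
  trans (^ₚ-homo (normalise a) k ρ) (cong (_^ᶻ k) (normalise-correct a ρ))

Monomial : ℕ → Set
Monomial n = ℤ × Vec ℕ n

powers : ∀ {n} → Vec ℤ n → Vec ℕ n → ℤ
powers [] [] = 1ℤ
powers (x ∷ ρ) (e ∷ es) = x ^ᶻ e ℤ.* powers ρ es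

⟦_⟧ₘ : ∀ {n} → List (Monomial n) → Vec ℤ n → ℤ
⟦ [] ⟧ₘ ρ = 0ℤ
⟦ (c , es) ∷ ms ⟧ₘ ρ = c ℤ.* powers ρ es ℤ.+ ⟦ ms ⟧ₘ ρ

raise : ∀ {n} → ℕ → Monomial n → Monomial (suc n)
raise k (c , es) = c , k ∷ es

monomials : ∀ {n} → Poly n → List (Monomial n)
monomialsFrom : ∀ {n} → ℕ → List (Poly n) → List (Monomial (suc n))
monomials {zero} c = (c , []) ∷ []
monomials {suc n} cs = monomialsFrom 0 cs
monomialsFrom k [] = []
monomialsFrom k (c ∷ cs) = map (raise k) (monomials c) ++ monomialsFrom (suc k) cs

⟦++⟧ₘ : ∀ {n} (ms ns : List (Monomial n)) ρ → ⟦ ms ++ ns ⟧ₘ ρ ≡ ⟦ ms ⟧ₘ ρ ℤ.+ ⟦ ns ⟧ₘ ρ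
⟦++⟧ₘ [] ns ρ = sym (ℤ.+-identityˡ (⟦ ns ⟧ₘ ρ))
⟦++⟧ₘ ((c , es) ∷ ms) ns ρ =
  trans (cong (λ v → c ℤ.* powers ρ es ℤ.+ v) (⟦++⟧ₘ ms ns ρ)) (sym (ℤ.+-assoc (c ℤ.* powers ρ es) (⟦ ms ⟧ₘ ρ) (⟦ ns ⟧ₘ ρ)))

⟦raise⟧ₘ : ∀ {n} k (ms : List (Monomial n)) x ρ → ⟦ map (raise k) ms ⟧ₘ (x ∷ ρ) ≡ x ^ᶻ k ℤ.* ⟦ ms ⟧ₘ ρ
⟦raise⟧ₘ k [] x ρ = sym (ℤ.*-zeroʳ (x ^ᶻ k))
⟦raise⟧ₘ k ((c , es) ∷ ms) x ρ = begin
  c ℤ.* (x ^ᶻ k ℤ.* powers ρ es) ℤ.+ ⟦ map (raise k) ms ⟧ₘ (x ∷ ρ)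
    ≡⟨ cong (λ v → c ℤ.* (x ^ᶻ k ℤ.* powers ρ es) ℤ.+ v) (⟦raise⟧ₘ k ms x ρ) ⟩
  c ℤ.* (x ^ᶻ k ℤ.* powers ρ es) ℤ.+ x ^ᶻ k ℤ.* ⟦ ms ⟧ₘ ρ
    ≡⟨ lemma c (x ^ᶻ k) (powers ρ es) (⟦ ms ⟧ₘ ρ) ⟩
  x ^ᶻ k ℤ.* (c ℤ.* powers ρ es ℤ.+ ⟦ ms ⟧ₘ ρ) ∎
  where
  open ≡-Reasoning
  lemma : ∀ c y z w → c ℤ.* (y ℤ.* z) ℤ.+ y ℤ.* w ≡ y ℤ.* (c ℤ.* z ℤ.+ w)
  lemma = solve-∀

monomials-correct : ∀ {n} (a : Poly n) ρ → ⟦ monomials a ⟧ₘ ρ ≡ ⟦ a ⟧ₚ ρ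
monomialsFrom-correct : ∀ {n} k (as : List (Poly n)) x ρ →
  ⟦ monomialsFrom k as ⟧ₘ (x ∷ ρ) ≡ x ^ᶻ k ℤ.* horner as x ρ
monomials-correct {zero} c [] = trans (ℤ.+-identityʳ (c ℤ.* 1ℤ)) (ℤ.*-identityʳ c)
monomials-correct {suc n} as (x ∷ ρ) =
  trans (monomialsFrom-correct 0 as x ρ) (ℤ.*-identityˡ (horner as x ρ))
monomialsFrom-correct k [] x ρ = sym (ℤ.*-zeroʳ (x ^ᶻ k))
monomialsFrom-correct k (a ∷ as) x ρ = begin
  ⟦ map (raise k) (monomials a) ++ monomialsFrom (suc k) as ⟧ₘ (x ∷ ρ)
    ≡⟨ ⟦++⟧ₘ (map (raise k) (monomials a)) (monomialsFrom (suc k) as) (x ∷ ρ) ⟩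
  ⟦ map (raise k) (monomials a) ⟧ₘ (x ∷ ρ) ℤ.+ ⟦ monomialsFrom (suc k) as ⟧ₘ (x ∷ ρ)
    ≡⟨ cong₂ ℤ._+_ (⟦raise⟧ₘ k (monomials a) x ρ) (monomialsFrom-correct (suc k) as x ρ) ⟩
  x ^ᶻ k ℤ.* ⟦ monomials a ⟧ₘ ρ ℤ.+ x ℤ.* x ^ᶻ k ℤ.* horner as x ρ
    ≡⟨ cong (λ v → x ^ᶻ k ℤ.* v ℤ.+ x ℤ.* x ^ᶻ k ℤ.* horner as x ρ) (monomials-correct a ρ) ⟩
  x ^ᶻ k ℤ.* ⟦ a ⟧ₚ ρ ℤ.+ x ℤ.* x ^ᶻ k ℤ.* horner as x ρ
    ≡⟨ lemma (x ^ᶻ k) (⟦ a ⟧ₚ ρ) x (horner as x ρ) ⟩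
  x ^ᶻ k ℤ.* (⟦ a ⟧ₚ ρ ℤ.+ x ℤ.* horner as x ρ) ∎
  where
  open ≡-Reasoning
  lemma : ∀ y a x h → y ℤ.* a ℤ.+ x ℤ.* y ℤ.* h ≡ y ℤ.* (a ℤ.+ x ℤ.* h)
  lemma = solve-∀

expansion : ∀ {n} → Expr n → List (Monomial n)
expansion e = monomials (normalise e)

expansion-correct : ∀ {n} (e : Expr n) ρ → ⟦ expansion e ⟧ₘ ρ ≡ ⟦ e ⟧ ρ
expansion-correct e ρ = trans (monomials-correct (normalise e) ρ) (normalise-correct e ρ)

-- The expression is passed under its name e and matched with a ⊕ b by refl, so that the type
-- checker never compares the (large) expansion of a named expression with that of its body.
-- For the same reason all implicit arguments next to concrete expansions are given explicitly.
expansion-⊕-root : ∀ {n} {e} (a b : Expr n) ρ → e ≡ a ⊕ b → ⟦ a ⟧ ρ ≡ 0ℤ → ⟦ expansion e ⟧ₘ ρ ≡ ⟦ b ⟧ ρ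
expansion-⊕-root a b ρ refl a≡0 =
  trans (expansion-correct (a ⊕ b) ρ) (trans (cong (ℤ._+ ⟦ b ⟧ ρ) a≡0) (ℤ.+-identityˡ (⟦ b ⟧ ρ)))

expansion-⊖-root : ∀ {n} {e} (a b : Expr n) ρ → e ≡ a ⊖ b → ⟦ a ⟧ ρ ≡ 0ℤ → ℤ.∣ ⟦ expansion e ⟧ₘ ρ ∣ ≡ ℤ.∣ ⟦ b ⟧ ρ ∣
expansion-⊖-root a b ρ refl a≡0 = begin
  ℤ.∣ ⟦ expansion (a ⊖ b) ⟧ₘ ρ ∣ ≡⟨ cong ℤ.∣_∣ (expansion-correct (a ⊖ b) ρ) ⟩
  ℤ.∣ ⟦ a ⟧ ρ ℤ.- ⟦ b ⟧ ρ ∣        ≡⟨ cong (λ v → ℤ.∣ v ℤ.- ⟦ b ⟧ ρ ∣) a≡0 ⟩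
  ℤ.∣ 0ℤ ℤ.- ⟦ b ⟧ ρ ∣             ≡⟨ cong ℤ.∣_∣ (ℤ.+-identityˡ (ℤ.- ⟦ b ⟧ ρ)) ⟩
  ℤ.∣ ℤ.- ⟦ b ⟧ ρ ∣                ≡⟨ ℤ.∣-i∣≡∣i∣ (⟦ b ⟧ ρ) ⟩
  ℤ.∣ ⟦ b ⟧ ρ ∣                    ∎
  where open ≡-Reasoning

toℤ : ∀ {n} → Vec ℕ n → Vec ℤ n
toℤ = Vec.map (λ n → + n)

pos-^ : ∀ x k → + (x ^ k) ≡ (+ x) ^ᶻ k
pos-^ x zero = refl
pos-^ x (suc k) = trans (ℤ.pos-* x (x ^ k)) (cong (+ x ℤ.*_) (pos-^ x k))

powersℕ : ∀ {n} → Vec ℕ n → Vec ℕ n → ℕ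
powersℕ [] [] = 1
powersℕ (x ∷ ρ) (e ∷ es) = x ^ e * powersℕ ρ es

pos-powers : ∀ {n} (ρ es : Vec ℕ n) → + powersℕ ρ es ≡ powers (toℤ ρ) es
pos-powers [] [] = refl
pos-powers (x ∷ ρ) (e ∷ es) =
  trans (ℤ.pos-* (x ^ e) (powersℕ ρ es)) (cong₂ ℤ._*_ (pos-^ x e) (pos-powers ρ es))

weightedSum : ∀ {n} → (ℤ → ℕ) → (Vec ℕ n → ℕ) → List (Monomial n) → ℕ
weightedSum w f [] = 0
weightedSum w f ((c , es) ∷ ms) = w c * f es + weightedSum w f ms

positivePart : ℤ → ℕ
positivePart (+ n) = n
positivePart -[1+ n ] = 0

∣⟦⟧ₘ∣≤weightedSum-∣∣ : ∀ {n} (ms : List (Monomial n)) ρ →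
  ℤ.∣ ⟦ ms ⟧ₘ (toℤ ρ) ∣ ≤ weightedSum ℤ.∣_∣ (powersℕ ρ) ms
∣⟦⟧ₘ∣≤weightedSum-∣∣ [] ρ = ℕ.≤-refl
∣⟦⟧ₘ∣≤weightedSum-∣∣ ((c , es) ∷ ms) ρ = begin
  ℤ.∣ c ℤ.* powers ρ′ es ℤ.+ ⟦ ms ⟧ₘ ρ′ ∣      ≤⟨ ℤ.∣i+j∣≤∣i∣+∣j∣ (c ℤ.* powers ρ′ es) (⟦ ms ⟧ₘ ρ′) ⟩
  ℤ.∣ c ℤ.* powers ρ′ es ∣ + ℤ.∣ ⟦ ms ⟧ₘ ρ′ ∣   ≡⟨ cong (λ v → ℤ.∣ c ℤ.* v ∣ + ℤ.∣ ⟦ ms ⟧ₘ ρ′ ∣) (sym (pos-powers ρ es)) ⟩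
  ℤ.∣ c ℤ.* + powersℕ ρ es ∣ + ℤ.∣ ⟦ ms ⟧ₘ ρ′ ∣ ≡⟨ cong (_+ ℤ.∣ ⟦ ms ⟧ₘ ρ′ ∣) (ℤ.abs-* c (+ powersℕ ρ es)) ⟩
  ℤ.∣ c ∣ * powersℕ ρ es + ℤ.∣ ⟦ ms ⟧ₘ ρ′ ∣     ≤⟨ ℕ.+-monoʳ-≤ (ℤ.∣ c ∣ * powersℕ ρ es) (∣⟦⟧ₘ∣≤weightedSum-∣∣ ms ρ) ⟩
  ℤ.∣ c ∣ * powersℕ ρ es + weightedSum ℤ.∣_∣ (powersℕ ρ) ms ∎
  where
  open ℕ.≤-Reasoning
  ρ′ = toℤ ρ

⟦⟧ₘ≤weightedSum-positivePart : ∀ {n} (ms : List (Monomial n)) ρ →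
  ⟦ ms ⟧ₘ (toℤ ρ) ℤ.≤ + weightedSum positivePart (powersℕ ρ) ms
⟦⟧ₘ≤weightedSum-positivePart [] ρ = ℤ.≤-refl
⟦⟧ₘ≤weightedSum-positivePart ((c , es) ∷ ms) ρ = begin
  c ℤ.* powers ρ′ es ℤ.+ ⟦ ms ⟧ₘ ρ′
    ≡⟨ cong (λ v → c ℤ.* v ℤ.+ ⟦ ms ⟧ₘ ρ′) (sym (pos-powers ρ es)) ⟩
  c ℤ.* + powersℕ ρ es ℤ.+ ⟦ ms ⟧ₘ ρ′
    ≤⟨ ℤ.+-mono-≤ (term≤ c) (⟦⟧ₘ≤weightedSum-positivePart ms ρ) ⟩
  + (positivePart c * powersℕ ρ es) ℤ.+ + weightedSum positivePart (powersℕ ρ) ms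
    ≡⟨ ℤ.pos-+ (positivePart c * powersℕ ρ es) (weightedSum positivePart (powersℕ ρ) ms) ⟨
  + (positivePart c * powersℕ ρ es + weightedSum positivePart (powersℕ ρ) ms) ∎
  where
  open ℤ.≤-Reasoning
  ρ′ = toℤ ρ
  term≤ : ∀ c → c ℤ.* + powersℕ ρ es ℤ.≤ + (positivePart c * powersℕ ρ es)
  term≤ (+ n) = ℤ.≤-reflexive (sym (ℤ.pos-* n (powersℕ ρ es)))
  term≤ -[1+ n ] = ℤ.≤-trans (ℤ.≤-reflexive (ℤ.-◃n≡-n (suc n * powersℕ ρ es))) ℤ.neg-≤-pos

∣+m-+n∣≡∣m-n∣ : ∀ m n → ℤ.∣ + m ℤ.- + n ∣ ≡ ∣ m - n ∣
∣+m-+n∣≡∣m-n∣ m n with ℕ.≤-total m n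
... | inj₁ m≤n = trans (cong ℤ.∣_∣ (ℤ.m-n≡m⊖n m n)) (trans (ℤ.∣⊖∣-≤ m≤n) (sym (ℕ.m≤n⇒∣m-n∣≡n∸m m≤n)))
... | inj₂ n≤m = trans (cong ℤ.∣_∣ (ℤ.m-n≡m⊖n m n))
  (trans (ℤ.∣m⊖n∣≡∣n⊖m∣ m n) (trans (ℤ.∣⊖∣-≤ n≤m) (sym (ℕ.m≤n⇒∣n-m∣≡n∸m n≤m))))

-- Domination of monomials when q ≥ 3600 and q³ ≤ 2p

^-distribʳ-* : ∀ m n k → (m * n) ^ k ≡ m ^ k * n ^ k
^-distribʳ-* m n zero = refl
^-distribʳ-* m n (suc k) = begin
  m * n * (m * n) ^ k     ≡⟨ cong (m * n *_) (^-distribʳ-* m n k) ⟩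
  m * n * (m ^ k * n ^ k) ≡⟨ lemma m n (m ^ k) (n ^ k) ⟩
  m * m ^ k * (n * n ^ k) ∎
  where
  open ≡-Reasoning
  lemma : ∀ m n a b → m * n * (a * b) ≡ m * a * (n * b)
  lemma = ℕ-Solver.solve-∀

-- Each factor q³ can be traded for d p, and each surplus factor q absorbs a factor b.
dominate : ∀ {b d p q} i j a s I J → .{{NonZero p}} → .{{NonZero q}} → b ≤ q → q ^ 3 ≤ d * p →
  j + s ≤ J + 3 * a → i + a ≤ I → b ^ s * (p ^ i * q ^ j) ≤ d ^ a * (p ^ I * q ^ J)
dominate {b} {d} {p} {q} i j a s I J b≤q q³≤dp j+s≤ i+a≤ = begin
  b ^ s * (p ^ i * q ^ j)             ≤⟨ ℕ.*-monoˡ-≤ (p ^ i * q ^ j) (ℕ.^-monoˡ-≤ s b≤q) ⟩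
  q ^ s * (p ^ i * q ^ j)             ≡⟨ lemma₁ (q ^ s) (p ^ i) (q ^ j) ⟩
  p ^ i * (q ^ j * q ^ s)             ≡⟨ cong (p ^ i *_) (ℕ.^-distribˡ-+-* q j s) ⟨
  p ^ i * q ^ (j + s)                 ≤⟨ ℕ.*-monoʳ-≤ (p ^ i) (ℕ.^-monoʳ-≤ q j+s≤) ⟩
  p ^ i * q ^ (J + 3 * a)             ≡⟨ cong (p ^ i *_) (ℕ.^-distribˡ-+-* q J (3 * a)) ⟩
  p ^ i * (q ^ J * q ^ (3 * a))       ≡⟨ cong (λ v → p ^ i * (q ^ J * v)) (ℕ.^-*-assoc q 3 a) ⟨
  p ^ i * (q ^ J * (q ^ 3) ^ a)       ≤⟨ ℕ.*-monoʳ-≤ (p ^ i) (ℕ.*-monoʳ-≤ (q ^ J) (ℕ.^-monoˡ-≤ a q³≤dp)) ⟩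
  p ^ i * (q ^ J * (d * p) ^ a)       ≡⟨ cong (λ v → p ^ i * (q ^ J * v)) (^-distribʳ-* d p a) ⟩
  p ^ i * (q ^ J * (d ^ a * p ^ a))   ≡⟨ lemma₂ (p ^ i) (q ^ J) (d ^ a) (p ^ a) ⟩
  d ^ a * (p ^ i * p ^ a * q ^ J)     ≡⟨ cong (λ v → d ^ a * (v * q ^ J)) (ℕ.^-distribˡ-+-* p i a) ⟨
  d ^ a * (p ^ (i + a) * q ^ J)       ≤⟨ ℕ.*-monoʳ-≤ (d ^ a) (ℕ.*-monoˡ-≤ (q ^ J) (ℕ.^-monoʳ-≤ p i+a≤)) ⟩
  d ^ a * (p ^ I * q ^ J)             ∎
  where
  open ℕ.≤-Reasoning
  lemma₁ : ∀ a b c → a * (b * c) ≡ b * (c * a)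
  lemma₁ = ℕ-Solver.solve-∀
  lemma₂ : ∀ a b c d → a * (b * (c * d)) ≡ c * (a * d * b)
  lemma₂ = ℕ-Solver.solve-∀

record Large (p q : ℕ) : Set where
  field
    3600≤q : 3600 ≤ q
    q³≤2p : q ^ 3 ≤ 2 * p

  instance
    q≢0 : NonZero q
    q≢0 = >-nonZero (ℕ.<-≤-trans (s≤s z≤n) 3600≤q)

    p≢0 : NonZero p
    p≢0 = >-nonZero (ℕ.*-cancelˡ-< 2 0 p (ℕ.<-≤-trans (ℕ.m^n>0 q 3) q³≤2p))

-- pⁱqʲ is compared with p^I q^J by trading each of the I − i missing factors p for q³ (a factor 2
-- is lost each time, as q³ ≤ 2p); the surplus factors q then absorb up to S factors 3600.
Dominated : ℕ → ℕ → ℕ → ℕ → Set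
Dominated I J i j = i ≤ I × j ≤ J + 3 * (I ∸ i)

absorbed : ℕ → ℕ → ℕ → ℕ → ℕ → ℕ
absorbed S I J i j = S ⊓ (J + 3 * (I ∸ i) ∸ j)

weight : ℕ → ℕ → ℕ → ℕ → ℕ → ℕ
weight S I J i j = 3600 ^ (S ∸ absorbed S I J i j) * 2 ^ (I ∸ i)

dominated-bound : ∀ {p q} S {I J i j} → Large p q → Dominated I J i j →
  3600 ^ S * (p ^ i * q ^ j) ≤ weight S I J i j * (p ^ I * q ^ J)
dominated-bound {p} {q} S {I} {J} {i} {j} large (i≤I , j≤) = begin
  3600 ^ S * (p ^ i * q ^ j)
    ≡⟨ cong (λ v → 3600 ^ v * (p ^ i * q ^ j)) (ℕ.m∸n+n≡m s≤S) ⟨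
  3600 ^ (S ∸ s + s) * (p ^ i * q ^ j)
    ≡⟨ cong (_* (p ^ i * q ^ j)) (ℕ.^-distribˡ-+-* 3600 (S ∸ s) s) ⟩
  3600 ^ (S ∸ s) * 3600 ^ s * (p ^ i * q ^ j)
    ≡⟨ ℕ.*-assoc (3600 ^ (S ∸ s)) (3600 ^ s) (p ^ i * q ^ j) ⟩
  3600 ^ (S ∸ s) * (3600 ^ s * (p ^ i * q ^ j))
    ≤⟨ ℕ.*-monoʳ-≤ (3600 ^ (S ∸ s)) (dominate i j a s I J 3600≤q q³≤2p j+s≤ i+a≤I) ⟩
  3600 ^ (S ∸ s) * (2 ^ a * (p ^ I * q ^ J))
    ≡⟨ ℕ.*-assoc (3600 ^ (S ∸ s)) (2 ^ a) (p ^ I * q ^ J) ⟨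
  weight S I J i j * (p ^ I * q ^ J) ∎
  where
  open ℕ.≤-Reasoning
  open Large large
  a = I ∸ i
  s = absorbed S I J i j
  s≤S : s ≤ S
  s≤S = ℕ.m⊓n≤m S (J + 3 * a ∸ j)
  j+s≤ : j + s ≤ J + 3 * a
  j+s≤ = ℕ.≤-trans (ℕ.+-monoʳ-≤ j (ℕ.m⊓n≤n S (J + 3 * a ∸ j))) (ℕ.≤-reflexive (ℕ.m+[n∸m]≡n j≤))
  i+a≤I : i + a ≤ I
  i+a≤I = ℕ.≤-reflexive (ℕ.m+[n∸m]≡n i≤I)

Certified : ∀ {n} → (ℤ → ℕ) → (Vec ℕ n → Set) → List (Monomial n) → Set
Certified w P = All (λ m → w (proj₁ m) ≡ 0 ⊎ P (proj₂ m))

certified? : ∀ {n} w {P : Vec ℕ n → Set} → (∀ es → Dec (P es)) → ∀ ms → Dec (Certified w P ms)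
certified? w P? = all? (λ m → (w (proj₁ m) ≟ 0) ⊎-dec P? (proj₂ m))

weightedSum-bound : ∀ {n} (w : ℤ → ℕ) {P : Vec ℕ n → Set} {f g : Vec ℕ n → ℕ} A Y →
  (∀ {es} → P es → A * f es ≤ g es * Y) →
  ∀ ms → Certified w P ms → A * weightedSum w f ms ≤ weightedSum w g ms * Y
weightedSum-bound w A Y bound [] [] = ℕ.≤-reflexive (ℕ.*-zeroʳ A)
weightedSum-bound w {P} {f} {g} A Y bound ((c , es) ∷ ms) (term ∷ terms) = begin
  A * (w c * f es + weightedSum w f ms)
    ≡⟨ lemma₁ A (w c) (f es) (weightedSum w f ms) ⟩
  w c * (A * f es) + A * weightedSum w f ms
    ≤⟨ ℕ.+-mono-≤ (termBound term) (weightedSum-bound w A Y bound ms terms) ⟩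
  w c * (g es * Y) + weightedSum w g ms * Y
    ≡⟨ lemma₂ (w c) (g es) Y (weightedSum w g ms) ⟩
  (w c * g es + weightedSum w g ms) * Y ∎
  where
  open ℕ.≤-Reasoning
  lemma₁ : ∀ A v x r → A * (v * x + r) ≡ v * (A * x) + A * r
  lemma₁ = ℕ-Solver.solve-∀
  lemma₂ : ∀ v x Y r → v * (x * Y) + r * Y ≡ (v * x + r) * Y
  lemma₂ = ℕ-Solver.solve-∀
  termBound : w c ≡ 0 ⊎ P es → w c * (A * f es) ≤ w c * (g es * Y)
  termBound (inj₁ wc≡0) rewrite wc≡0 = z≤n
  termBound (inj₂ Pes) = ℕ.*-monoʳ-≤ (w c) (bound Pes)

pqx : ℕ → ℕ → ℕ → Vec ℕ 3
pqx p q x = p ∷ q ∷ x ∷ []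

DominatedMonomial : ℕ → ℕ → Vec ℕ 3 → Set
DominatedMonomial I J (i ∷ j ∷ k ∷ []) = Dominated I J i j

boundedCost : ℕ → ℕ → ℕ → ℕ → Vec ℕ 3 → ℕ
boundedCost S I J M (i ∷ j ∷ k ∷ []) = weight S I J i j * M ^ k

bounded-monomial : ∀ {p q x M} S {I J} es → Large p q → x ≤ M → DominatedMonomial I J es →
  3600 ^ S * powersℕ (pqx p q x) es ≤ boundedCost S I J M es * (p ^ I * q ^ J)
bounded-monomial {p} {q} {x} {M} S {I} {J} (i ∷ j ∷ k ∷ []) large x≤M dom = begin
  3600 ^ S * (p ^ i * (q ^ j * (x ^ k * 1)))
    ≡⟨ lemma₁ (3600 ^ S) (p ^ i) (q ^ j) (x ^ k) ⟩
  3600 ^ S * (p ^ i * q ^ j) * x ^ k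
    ≤⟨ ℕ.*-mono-≤ (dominated-bound S {I} {J} large dom) (ℕ.^-monoˡ-≤ k x≤M) ⟩
  weight S I J i j * (p ^ I * q ^ J) * M ^ k
    ≡⟨ lemma₂ (weight S I J i j) (p ^ I * q ^ J) (M ^ k) ⟩
  weight S I J i j * M ^ k * (p ^ I * q ^ J) ∎
  where
  open ℕ.≤-Reasoning
  lemma₁ : ∀ A P Q X → A * (P * (Q * (X * 1))) ≡ A * (P * Q) * X
  lemma₁ = ℕ-Solver.solve-∀
  lemma₂ : ∀ w Y X → w * Y * X ≡ w * X * Y
  lemma₂ = ℕ-Solver.solve-∀

DominatedLinear : ℕ → ℕ → Vec ℕ 3 → Set
DominatedLinear I J (i ∷ j ∷ k ∷ []) = Dominated I J (i + (k ∸ 1)) (j + (k ∸ 1))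

linearCost : ℕ → ℕ → ℕ → Vec ℕ 3 → ℕ
linearCost S I J (i ∷ j ∷ k ∷ []) = weight S I J (i + (k ∸ 1)) (j + (k ∸ 1)) * 2 ^ (k ∸ 1)

^≤-linear : ∀ {x y} k → 1 ≤ x → x ≤ y → x ^ k ≤ y ^ (k ∸ 1) * x
^≤-linear zero 1≤x x≤y = ℕ.≤-trans 1≤x (ℕ.≤-reflexive (sym (ℕ.*-identityˡ _)))
^≤-linear {x} {y} (suc k) 1≤x x≤y = begin
  x * x ^ k ≤⟨ ℕ.*-monoʳ-≤ x (ℕ.^-monoˡ-≤ k x≤y) ⟩
  x * y ^ k ≡⟨ ℕ.*-comm x (y ^ k) ⟩
  y ^ k * x ∎
  where open ℕ.≤-Reasoning

linear-monomial : ∀ {p q x} S {I J} es → Large p q → 1 ≤ x → x ≤ 2 * p * q → DominatedLinear I J es →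
  3600 ^ S * powersℕ (pqx p q x) es ≤ linearCost S I J es * (p ^ I * q ^ J * x)
linear-monomial {p} {q} {x} S {I} {J} (i ∷ j ∷ k ∷ []) large 1≤x x≤2pq dom = begin
  3600 ^ S * (p ^ i * (q ^ j * (x ^ k * 1)))
    ≤⟨ ℕ.*-monoʳ-≤ (3600 ^ S) (ℕ.*-monoʳ-≤ (p ^ i) (ℕ.*-monoʳ-≤ (q ^ j) (ℕ.*-monoˡ-≤ 1 (^≤-linear k 1≤x x≤2pq)))) ⟩
  3600 ^ S * (p ^ i * (q ^ j * ((2 * p * q) ^ k′ * x * 1)))
    ≡⟨ cong (λ v → 3600 ^ S * (p ^ i * (q ^ j * (v * x * 1))))
            (trans (^-distribʳ-* (2 * p) q k′) (cong (_* q ^ k′) (^-distribʳ-* 2 p k′))) ⟩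
  3600 ^ S * (p ^ i * (q ^ j * (2 ^ k′ * p ^ k′ * q ^ k′ * x * 1)))
    ≡⟨ lemma₁ (3600 ^ S) (p ^ i) (q ^ j) (2 ^ k′) (p ^ k′) (q ^ k′) x ⟩
  2 ^ k′ * (3600 ^ S * (p ^ i * p ^ k′ * (q ^ j * q ^ k′))) * x
    ≡⟨ cong₂ (λ u v → 2 ^ k′ * (3600 ^ S * (u * v)) * x) (ℕ.^-distribˡ-+-* p i k′) (ℕ.^-distribˡ-+-* q j k′) ⟨
  2 ^ k′ * (3600 ^ S * (p ^ (i + k′) * q ^ (j + k′))) * x
    ≤⟨ ℕ.*-monoˡ-≤ x (ℕ.*-monoʳ-≤ (2 ^ k′) (dominated-bound S {I} {J} large dom)) ⟩
  2 ^ k′ * (weight S I J (i + k′) (j + k′) * (p ^ I * q ^ J)) * x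
    ≡⟨ lemma₂ (2 ^ k′) (weight S I J (i + k′) (j + k′)) (p ^ I * q ^ J) x ⟩
  weight S I J (i + k′) (j + k′) * 2 ^ k′ * (p ^ I * q ^ J * x) ∎
  where
  open ℕ.≤-Reasoning
  k′ = k ∸ 1
  lemma₁ : ∀ A P Q T P′ Q′ x → A * (P * (Q * (T * P′ * Q′ * x * 1))) ≡ T * (A * (P * P′ * (Q * Q′))) * x
  lemma₁ = ℕ-Solver.solve-∀
  lemma₂ : ∀ T w Y x → T * (w * Y) * x ≡ w * T * (Y * x)
  lemma₂ = ℕ-Solver.solve-∀

dominated? : ∀ I J i j → Dec (Dominated I J i j)
dominated? I J i j = (i ≤? I) ×-dec (j ≤? J + 3 * (I ∸ i))

dominatedMonomial? : ∀ I J es → Dec (DominatedMonomial I J es)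
dominatedMonomial? I J (i ∷ j ∷ k ∷ []) = dominated? I J i j

dominatedLinear? : ∀ I J es → Dec (DominatedLinear I J es)
dominatedLinear? I J (i ∷ j ∷ k ∷ []) = dominated? I J (i + (k ∸ 1)) (j + (k ∸ 1))

cancel-bound-< : ∀ A k {V C Y} → .{{NonZero Y}} → A * V ≤ C * Y → C < k * A → V < k * Y
cancel-bound-< A k {V} {C} {Y} AV≤CY C<kA = ℕ.*-cancelˡ-< A V (k * Y) (begin-strict
  A * V       ≤⟨ AV≤CY ⟩
  C * Y       <⟨ ℕ.*-monoˡ-< Y C<kA ⟩
  k * A * Y   ≡⟨ lemma k A Y ⟩
  A * (k * Y) ∎)
  where
  open ℕ.≤-Reasoning
  lemma : ∀ k A Y → k * A * Y ≡ A * (k * Y)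
  lemma = ℕ-Solver.solve-∀

linear-dominated : ∀ S I J k ms {p q x} → Large p q → 1 ≤ x → x ≤ 2 * p * q →
  Certified positivePart (DominatedLinear I J) ms →
  weightedSum positivePart (linearCost S I J) ms < k * 3600 ^ S →
  ⟦ ms ⟧ₘ (toℤ (pqx p q x)) ℤ.< + (k * (p ^ I * q ^ J * x))
linear-dominated S I J k ms {p} {q} {x} large 1≤x x≤2pq certified bound =
  ℤ.≤-<-trans (⟦⟧ₘ≤weightedSum-positivePart ms (pqx p q x)) (ℤ.+<+ (cancel-bound-< (3600 ^ S) k AV≤CY bound))
  where
  open Large large
  instance
    Y≢0 : NonZero (p ^ I * q ^ J * x)
    Y≢0 = ℕ.m*n≢0 (p ^ I * q ^ J) x {{ℕ.m*n≢0 (p ^ I) (q ^ J) {{ℕ.m^n≢0 p I}} {{ℕ.m^n≢0 q J}}}} {{>-nonZero 1≤x}}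
  AV≤CY : 3600 ^ S * weightedSum positivePart (powersℕ (pqx p q x)) ms ≤
          weightedSum positivePart (linearCost S I J) ms * (p ^ I * q ^ J * x)
  AV≤CY = weightedSum-bound positivePart (3600 ^ S) (p ^ I * q ^ J * x)
    (λ {es} → linear-monomial S {I} {J} es large 1≤x x≤2pq) ms certified

bounded-dominated : ∀ S I J k ms {p q x M} → Large p q → x ≤ M →
  Certified ℤ.∣_∣ (DominatedMonomial I J) ms →
  weightedSum ℤ.∣_∣ (boundedCost S I J M) ms < k * 3600 ^ S →
  ℤ.∣ ⟦ ms ⟧ₘ (toℤ (pqx p q x)) ∣ < k * (p ^ I * q ^ J)
bounded-dominated S I J k ms {p} {q} {x} {M} large x≤M certified bound =
  ℕ.≤-<-trans (∣⟦⟧ₘ∣≤weightedSum-∣∣ ms (pqx p q x)) (cancel-bound-< (3600 ^ S) k AV≤CY bound)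
  where
  open Large large
  instance
    Y≢0 : NonZero (p ^ I * q ^ J)
    Y≢0 = ℕ.m*n≢0 (p ^ I) (q ^ J) {{ℕ.m^n≢0 p I}} {{ℕ.m^n≢0 q J}}
  AV≤CY : 3600 ^ S * weightedSum ℤ.∣_∣ (powersℕ (pqx p q x)) ms ≤
          weightedSum ℤ.∣_∣ (boundedCost S I J M) ms * (p ^ I * q ^ J)
  AV≤CY = weightedSum-bound ℤ.∣_∣ (3600 ^ S) (p ^ I * q ^ J)
    (λ {es} → bounded-monomial S {I} {J} es large x≤M) ms certified

infixl 6 _‵+_
infixl 7 _‵*_

data ℕTerm : Set where
  ‵_ : ℕ → ℕTerm
  _‵+_ _‵*_ : ℕTerm → ℕTerm → ℕTerm

⟦_⟧ᴺ : ℕTerm → ℕ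
⟦ ‵ n ⟧ᴺ = n
⟦ a ‵+ b ⟧ᴺ = ⟦ a ⟧ᴺ + ⟦ b ⟧ᴺ
⟦ a ‵* b ⟧ᴺ = ⟦ a ⟧ᴺ * ⟦ b ⟧ᴺ

⟦_⟧ᶻ : ℕTerm → ℤ
⟦ ‵ n ⟧ᶻ = + n
⟦ a ‵+ b ⟧ᶻ = ⟦ a ⟧ᶻ ℤ.+ ⟦ b ⟧ᶻ
⟦ a ‵* b ⟧ᶻ = ⟦ a ⟧ᶻ ℤ.* ⟦ b ⟧ᶻ

pos-⟦⟧ : ∀ e → + ⟦ e ⟧ᴺ ≡ ⟦ e ⟧ᶻ
pos-⟦⟧ (‵ n) = refl
pos-⟦⟧ (a ‵+ b) = trans (ℤ.pos-+ ⟦ a ⟧ᴺ ⟦ b ⟧ᴺ) (cong₂ ℤ._+_ (pos-⟦⟧ a) (pos-⟦⟧ b))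
pos-⟦⟧ (a ‵* b) = trans (ℤ.pos-* ⟦ a ⟧ᴺ ⟦ b ⟧ᴺ) (cong₂ ℤ._*_ (pos-⟦⟧ a) (pos-⟦⟧ b))

⟦⟧ᶻ-cong : ∀ a b → ⟦ a ⟧ᴺ ≡ ⟦ b ⟧ᴺ → ⟦ a ⟧ᶻ ≡ ⟦ b ⟧ᶻ
⟦⟧ᶻ-cong a b eq = trans (sym (pos-⟦⟧ a)) (trans (cong +_ eq) (pos-⟦⟧ b))

⟦⟧ᶻ-injective : ∀ a b → ⟦ a ⟧ᶻ ≡ ⟦ b ⟧ᶻ → ⟦ a ⟧ᴺ ≡ ⟦ b ⟧ᴺ
⟦⟧ᶻ-injective a b eq = ℤ.+-injective (trans (pos-⟦⟧ a) (trans eq (sym (pos-⟦⟧ b))))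

-- Q near N = p² + 2pq − 2q²

Qᴱ : ∀ {n} → Expr n → Expr n → Expr n → Expr n
Qᴱ p q t =
  t ⊛ 10
  ⊕ ((con (+ 2) ⊗ q ⊛ 2 ⊕ p ⊛ 2) ⊗ (con (+ 3) ⊗ q ⊛ 2 ⊖ con (+ 2) ⊗ p ⊛ 2)) ⊗ t ⊛ 8
  ⊕ (q ⊛ 8 ⊕ con (+ 10) ⊗ p ⊛ 2 ⊗ q ⊛ 6 ⊕ con (+ 4) ⊗ p ⊛ 4 ⊗ q ⊛ 4
        ⊖ con (+ 14) ⊗ p ⊛ 6 ⊗ q ⊛ 2 ⊕ p ⊛ 8) ⊗ t ⊛ 6
  ⊖ p ⊛ 2 ⊗ q ⊛ 2 ⊗ (q ⊛ 8 ⊖ con (+ 14) ⊗ p ⊛ 2 ⊗ q ⊛ 6 ⊕ con (+ 4) ⊗ p ⊛ 4 ⊗ q ⊛ 4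
        ⊕ con (+ 10) ⊗ p ⊛ 6 ⊗ q ⊛ 2 ⊕ p ⊛ 8) ⊗ t ⊛ 4
  ⊖ p ⊛ 6 ⊗ q ⊛ 6 ⊗ (q ⊛ 2 ⊕ con (+ 2) ⊗ p ⊛ 2) ⊗ (con (+ 3) ⊗ p ⊛ 2 ⊖ con (+ 2) ⊗ q ⊛ 2) ⊗ t ⊛ 2
  ⊖ q ⊛ 10 ⊗ p ⊛ 10
⟦Qᴱ⟧ : ∀ {n} (a b c : Expr n) ρ → ⟦ Qᴱ a b c ⟧ ρ ≡ Q (⟦ a ⟧ ρ) (⟦ b ⟧ ρ) (⟦ c ⟧ ρ)
⟦Qᴱ⟧ a b c ρ = refl

𝑝 𝑞 𝑥 : Expr 3
𝑝 = var Fin.zero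
𝑞 = var (Fin.suc Fin.zero)
𝑥 = var (Fin.suc (Fin.suc Fin.zero))

𝑵 : Expr 3
𝑵 = 𝑝 ⊛ 2 ⊕ con (+ 2) ⊗ 𝑝 ⊗ 𝑞 ⊖ con (+ 2) ⊗ 𝑞 ⊛ 2

Q≡0⇒⟦Qᴱ⟧≡0 : ∀ {p q x} c → Q (+ p) (+ q) (⟦ c ⟧ (toℤ (pqx p q x))) ≡ 0ℤ → ⟦ Qᴱ 𝑝 𝑞 c ⟧ (toℤ (pqx p q x)) ≡ 0ℤ
Q≡0⇒⟦Qᴱ⟧≡0 {p} {q} {x} c Q≡0 = trans (⟦Qᴱ⟧ 𝑝 𝑞 c (toℤ (pqx p q x))) Q≡0

⟦c𝑝ⁱ𝑞⟧ : ∀ c i {p q x} → ⟦ con (+ c) ⊗ 𝑝 ⊛ i ⊗ 𝑞 ⟧ (toℤ (pqx p q x)) ≡ + (c * p ^ i * q)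
⟦c𝑝ⁱ𝑞⟧ c i {p} {q} = begin
  + c ℤ.* (+ p) ^ᶻ i ℤ.* + q    ≡⟨ cong (λ v → + c ℤ.* v ℤ.* + q) (pos-^ p i) ⟨
  + c ℤ.* + (p ^ i) ℤ.* + q     ≡⟨ cong (ℤ._* + q) (ℤ.pos-* c (p ^ i)) ⟨
  + (c * p ^ i) ℤ.* + q         ≡⟨ ℤ.pos-* (c * p ^ i) q ⟨
  + (c * p ^ i * q)             ∎
  where open ≡-Reasoning

shift-below : ∀ {p q t n} → t + 2 * q ^ 2 + n ≡ p ^ 2 + 2 * p * q → + t ≡ ⟦ 𝑵 ⊖ 𝑥 ⟧ (toℤ (pqx p q n))
shift-below {p} {q} {t} {n} eq = lemma (+ t) (+ p) (+ q) (+ n)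
  (⟦⟧ᶻ-cong (‵ t ‵+ ‵ 2 ‵* (‵ q ‵* (‵ q ‵* ‵ 1)) ‵+ ‵ n) (‵ p ‵* (‵ p ‵* ‵ 1) ‵+ ‵ 2 ‵* ‵ p ‵* ‵ q) eq)
  where
  lemma : ∀ T P Q M → T ℤ.+ + 2 ℤ.* (Q ℤ.* (Q ℤ.* 1ℤ)) ℤ.+ M ≡ P ℤ.* (P ℤ.* 1ℤ) ℤ.+ + 2 ℤ.* P ℤ.* Q →
          T ≡ P ℤ.* (P ℤ.* 1ℤ) ℤ.+ + 2 ℤ.* P ℤ.* Q ℤ.- + 2 ℤ.* (Q ℤ.* (Q ℤ.* 1ℤ)) ℤ.- M
  lemma T P Q M h = trans (l T Q M) (cong (λ v → v ℤ.- + 2 ℤ.* (Q ℤ.* (Q ℤ.* 1ℤ)) ℤ.- M) h)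
    where
    l : ∀ T Q M → T ≡ T ℤ.+ + 2 ℤ.* (Q ℤ.* (Q ℤ.* 1ℤ)) ℤ.+ M ℤ.- + 2 ℤ.* (Q ℤ.* (Q ℤ.* 1ℤ)) ℤ.- M
    l = solve-∀

shift-above : ∀ {p q t m} → t + 2 * q ^ 2 ≡ p ^ 2 + 2 * p * q + m → + t ≡ ⟦ 𝑵 ⊕ 𝑥 ⟧ (toℤ (pqx p q m))
shift-above {p} {q} {t} {m} eq = lemma (+ t) (+ p) (+ q) (+ m)
  (⟦⟧ᶻ-cong (‵ t ‵+ ‵ 2 ‵* (‵ q ‵* (‵ q ‵* ‵ 1))) (‵ p ‵* (‵ p ‵* ‵ 1) ‵+ ‵ 2 ‵* ‵ p ‵* ‵ q ‵+ ‵ m) eq)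
  where
  lemma : ∀ T P Q M → T ℤ.+ + 2 ℤ.* (Q ℤ.* (Q ℤ.* 1ℤ)) ≡ P ℤ.* (P ℤ.* 1ℤ) ℤ.+ + 2 ℤ.* P ℤ.* Q ℤ.+ M →
          T ≡ P ℤ.* (P ℤ.* 1ℤ) ℤ.+ + 2 ℤ.* P ℤ.* Q ℤ.- + 2 ℤ.* (Q ℤ.* (Q ℤ.* 1ℤ)) ℤ.+ M
  lemma T P Q M h = trans (l T Q) (trans (cong (λ v → v ℤ.- + 2 ℤ.* (Q ℤ.* (Q ℤ.* 1ℤ))) h) (r P Q M))
    where
    l : ∀ T Q → T ≡ T ℤ.+ + 2 ℤ.* (Q ℤ.* (Q ℤ.* 1ℤ)) ℤ.- + 2 ℤ.* (Q ℤ.* (Q ℤ.* 1ℤ))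
    l = solve-∀
    r : ∀ P Q M → P ℤ.* (P ℤ.* 1ℤ) ℤ.+ + 2 ℤ.* P ℤ.* Q ℤ.+ M ℤ.- + 2 ℤ.* (Q ℤ.* (Q ℤ.* 1ℤ)) ≡
                  P ℤ.* (P ℤ.* 1ℤ) ℤ.+ + 2 ℤ.* P ℤ.* Q ℤ.- + 2 ℤ.* (Q ℤ.* (Q ℤ.* 1ℤ)) ℤ.+ M
    r = solve-∀

-- At t = N + m the cuboid inequality 0 < (p² + t)(pq + t) − 2t² reads
-- m² + mp² + 3pqm + 4q⁴ < 4q²m + 6pq³, which fails once m ≥ 12.
excess≤11 : ∀ {p q t m} → Large p q → + t ≡ ⟦ 𝑵 ⊕ 𝑥 ⟧ (toℤ (pqx p q m)) →
  2 * t ^ 2 < (p ^ 2 + t) * (p * q + t) → m ≤ 11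
excess≤11 {p} {q} {t} {m} large t≡N+m cuboid with m ≤? 11
... | yes m≤11 = m≤11
... | no m≰11 = contradiction (ℕ.+-monoˡ-< gain cuboid) (ℕ.≤⇒≯ (begin
  (p ^ 2 + t) * (p * q + t) + gain ≤⟨ ℕ.+-monoʳ-≤ ((p ^ 2 + t) * (p * q + t)) gain≤loss ⟩
  (p ^ 2 + t) * (p * q + t) + loss ≡⟨ identity ⟨
  2 * t ^ 2 + gain                 ∎))
  where
  open ℕ.≤-Reasoning
  open Large large
  gain = 4 * q * q * m + 6 * p * (q * q * q)
  loss = m * m + m * (p * p) + 3 * p * q * m + 4 * (q * q * q * q)
  identity : 2 * t ^ 2 + gain ≡ (p ^ 2 + t) * (p * q + t) + loss
  identity = ⟦⟧ᶻ-injective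
    (‵ 2 ‵* (‵ t ‵* (‵ t ‵* ‵ 1)) ‵+ (‵ 4 ‵* ‵ q ‵* ‵ q ‵* ‵ m ‵+ ‵ 6 ‵* ‵ p ‵* (‵ q ‵* ‵ q ‵* ‵ q)))
    ((‵ p ‵* (‵ p ‵* ‵ 1) ‵+ ‵ t) ‵* (‵ p ‵* ‵ q ‵+ ‵ t) ‵+
       (‵ m ‵* ‵ m ‵+ ‵ m ‵* (‵ p ‵* ‵ p) ‵+ ‵ 3 ‵* ‵ p ‵* ‵ q ‵* ‵ m ‵+ ‵ 4 ‵* (‵ q ‵* ‵ q ‵* ‵ q ‵* ‵ q)))
    (ℤ-identity (+ p) (+ q) (+ m) (+ t) t≡N+m)
    where
    ℤ-identity : ∀ P Q M T → T ≡ P ℤ.* (P ℤ.* 1ℤ) ℤ.+ + 2 ℤ.* P ℤ.* Q ℤ.- + 2 ℤ.* (Q ℤ.* (Q ℤ.* 1ℤ)) ℤ.+ M →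
      + 2 ℤ.* (T ℤ.* (T ℤ.* 1ℤ)) ℤ.+ (+ 4 ℤ.* Q ℤ.* Q ℤ.* M ℤ.+ + 6 ℤ.* P ℤ.* (Q ℤ.* Q ℤ.* Q)) ≡
      (P ℤ.* (P ℤ.* 1ℤ) ℤ.+ T) ℤ.* (P ℤ.* Q ℤ.+ T) ℤ.+
        (M ℤ.* M ℤ.+ M ℤ.* (P ℤ.* P) ℤ.+ + 3 ℤ.* P ℤ.* Q ℤ.* M ℤ.+ + 4 ℤ.* (Q ℤ.* Q ℤ.* Q ℤ.* Q))
    ℤ-identity P Q M T refl = lemma P Q M
      where
      lemma : ∀ P Q M → let T = P ℤ.* (P ℤ.* 1ℤ) ℤ.+ + 2 ℤ.* P ℤ.* Q ℤ.- + 2 ℤ.* (Q ℤ.* (Q ℤ.* 1ℤ)) ℤ.+ M in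
        + 2 ℤ.* (T ℤ.* (T ℤ.* 1ℤ)) ℤ.+ (+ 4 ℤ.* Q ℤ.* Q ℤ.* M ℤ.+ + 6 ℤ.* P ℤ.* (Q ℤ.* Q ℤ.* Q)) ≡
        (P ℤ.* (P ℤ.* 1ℤ) ℤ.+ T) ℤ.* (P ℤ.* Q ℤ.+ T) ℤ.+
          (M ℤ.* M ℤ.+ M ℤ.* (P ℤ.* P) ℤ.+ + 3 ℤ.* P ℤ.* Q ℤ.* M ℤ.+ + 4 ℤ.* (Q ℤ.* Q ℤ.* Q ℤ.* Q))
      lemma = solve-∀
  q³≤2p′ : q * q * q ≤ 2 * p
  q³≤2p′ = ℕ.≤-trans (ℕ.≤-reflexive (lemma q)) q³≤2p
    where
    lemma : ∀ q → q * q * q ≡ q * (q * (q * 1))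
    lemma = ℕ-Solver.solve-∀
  4q≤3p : 4 * q ≤ 3 * p
  4q≤3p = begin
    4 * q         ≤⟨ ℕ.*-monoˡ-≤ q (ℕ.≤-trans (ℕ.≤ᵇ⇒≤ 4 3600 _) 3600≤q) ⟩
    q * q         ≤⟨ ℕ.m≤m*n (q * q) q ⟩
    q * q * q     ≤⟨ q³≤2p′ ⟩
    2 * p         ≤⟨ ℕ.*-monoˡ-≤ p (ℕ.≤ᵇ⇒≤ 2 3 _) ⟩
    3 * p         ∎
  gain≤loss : gain ≤ loss
  gain≤loss = begin
    4 * q * q * m + 6 * p * (q * q * q)
      ≤⟨ ℕ.+-mono-≤ (ℕ.*-monoˡ-≤ m (ℕ.*-monoˡ-≤ q 4q≤3p)) (ℕ.*-monoʳ-≤ (6 * p) q³≤2p′) ⟩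
    3 * p * q * m + 6 * p * (2 * p)
      ≡⟨ cong (_+_ (3 * p * q * m)) (lemma p) ⟩
    3 * p * q * m + 12 * (p * p)
      ≤⟨ ℕ.+-monoʳ-≤ (3 * p * q * m) (ℕ.*-monoˡ-≤ (p * p) (ℕ.≰⇒> m≰11)) ⟩
    3 * p * q * m + m * (p * p)
      ≤⟨ ℕ.m≤n+m _ (m * m + 4 * (q * q * q * q)) ⟩
    m * m + 4 * (q * q * q * q) + (3 * p * q * m + m * (p * p))
      ≡⟨ rearrange m p q ⟩
    loss ∎
    where
    lemma : ∀ p → 6 * p * (2 * p) ≡ 12 * (p * p)
    lemma = ℕ-Solver.solve-∀
    rearrange : ∀ m p q → m * m + 4 * (q * q * q * q) + (3 * p * q * m + m * (p * p)) ≡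
                          m * m + m * (p * p) + 3 * p * q * m + 4 * (q * q * q * q)
    rearrange = ℕ-Solver.solve-∀

below-N-lead : Expr 3
below-N-lead = con (+ 16) ⊗ 𝑝 ⊛ 17 ⊗ 𝑞 ⊗ 𝑥

below-N : Expr 3
below-N = Qᴱ 𝑝 𝑞 (𝑵 ⊖ 𝑥) ⊕ below-N-lead

below-N-certified : Certified positivePart (DominatedLinear 17 1) (expansion below-N)
below-N-certified = toWitness {a? = certified? positivePart (dominatedLinear? 17 1) (expansion below-N)} _

below-N-bound : weightedSum positivePart (linearCost 3 17 1) (expansion below-N) < 16 * 3600 ^ 3
below-N-bound = ℕ.≤ᵇ⇒≤ (suc (weightedSum positivePart (linearCost 3 17 1) (expansion below-N))) (16 * 3600 ^ 3) _

⟦below-N-lead⟧ : ∀ {p q n} → ⟦ below-N-lead ⟧ (toℤ (pqx p q n)) ≡ + (16 * (p ^ 17 * q ^ 1 * n))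
⟦below-N-lead⟧ {p} {q} {n} = begin
  ⟦ con (+ 16) ⊗ 𝑝 ⊛ 17 ⊗ 𝑞 ⟧ (toℤ (pqx p q n)) ℤ.* + n ≡⟨ cong (ℤ._* + n) (⟦c𝑝ⁱ𝑞⟧ 16 17 {p} {q} {n}) ⟩
  + (16 * p ^ 17 * q) ℤ.* + n                         ≡⟨ ℤ.pos-* (16 * p ^ 17 * q) n ⟨
  + (16 * p ^ 17 * q * n)                             ≡⟨ cong +_ (lemma (p ^ 17) q n) ⟩
  + (16 * (p ^ 17 * q ^ 1 * n))                       ∎
  where
  open ≡-Reasoning
  lemma : ∀ P b c → 16 * P * b * c ≡ 16 * (P * (b * 1) * c)
  lemma = ℕ-Solver.solve-∀

Q-below-N≢0 : ∀ {p q n} → Large p q → 1 ≤ n → n ≤ 2 * p * q → Q (+ p) (+ q) (⟦ 𝑵 ⊖ 𝑥 ⟧ (toℤ (pqx p q n))) ≢ 0ℤ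
Q-below-N≢0 {p} {q} {n} large 1≤n n≤2pq Q≡0 = ℤ.<-irrefl expansion≡lead
  (linear-dominated 3 17 1 16 (expansion below-N) {p} {q} {n} large 1≤n n≤2pq below-N-certified below-N-bound)
  where
  expansion≡lead : ⟦ expansion below-N ⟧ₘ (toℤ (pqx p q n)) ≡ + (16 * (p ^ 17 * q ^ 1 * n))
  expansion≡lead = trans
    (expansion-⊕-root {e = below-N} (Qᴱ 𝑝 𝑞 (𝑵 ⊖ 𝑥)) below-N-lead (toℤ (pqx p q n)) refl
      (Q≡0⇒⟦Qᴱ⟧≡0 {p} {q} {n} (𝑵 ⊖ 𝑥) Q≡0))
    (⟦below-N-lead⟧ {p} {q} {n})

above-N-lead : Expr 3
above-N-lead = con (+ 16) ⊗ 𝑝 ⊛ 16 ⊗ 𝑞 ⊗ (𝑝 ⊗ 𝑥 ⊖ con (+ 5) ⊗ 𝑞 ⊛ 3)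

above-N : Expr 3
above-N = Qᴱ 𝑝 𝑞 (𝑵 ⊕ 𝑥) ⊖ above-N-lead

above-N-certified : Certified ℤ.∣_∣ (DominatedMonomial 16 2) (expansion above-N)
above-N-certified = toWitness {a? = certified? ℤ.∣_∣ (dominatedMonomial? 16 2) (expansion above-N)} _

above-N-bound : weightedSum ℤ.∣_∣ (boundedCost 5 16 2 11) (expansion above-N) < 4080 * 3600 ^ 5
above-N-bound = ℕ.≤ᵇ⇒≤ (suc (weightedSum ℤ.∣_∣ (boundedCost 5 16 2 11) (expansion above-N))) (4080 * 3600 ^ 5) _

∣⟦above-N-lead⟧∣ : ∀ {p q m} → ℤ.∣ ⟦ above-N-lead ⟧ (toℤ (pqx p q m)) ∣ ≡ 16 * p ^ 16 * q * ∣ p * m - 5 * q ^ 3 ∣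
∣⟦above-N-lead⟧∣ {p} {q} {m} = begin
  ℤ.∣ ⟦ con (+ 16) ⊗ 𝑝 ⊛ 16 ⊗ 𝑞 ⟧ (toℤ (pqx p q m)) ℤ.* ⟦ 𝑝 ⊗ 𝑥 ⊖ con (+ 5) ⊗ 𝑞 ⊛ 3 ⟧ (toℤ (pqx p q m)) ∣
    ≡⟨ cong₂ (λ u v → ℤ.∣ u ℤ.* v ∣) (⟦c𝑝ⁱ𝑞⟧ 16 16 {p} {q} {m}) ⟦X⟧ ⟩
  ℤ.∣ + (16 * p ^ 16 * q) ℤ.* (+ (p * m) ℤ.- + (5 * q ^ 3)) ∣
    ≡⟨ ℤ.abs-* (+ (16 * p ^ 16 * q)) (+ (p * m) ℤ.- + (5 * q ^ 3)) ⟩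
  16 * p ^ 16 * q * ℤ.∣ + (p * m) ℤ.- + (5 * q ^ 3) ∣
    ≡⟨ cong (16 * p ^ 16 * q *_) (∣+m-+n∣≡∣m-n∣ (p * m) (5 * q ^ 3)) ⟩
  16 * p ^ 16 * q * ∣ p * m - 5 * q ^ 3 ∣ ∎
  where
  open ≡-Reasoning
  ⟦X⟧ : ⟦ 𝑝 ⊗ 𝑥 ⊖ con (+ 5) ⊗ 𝑞 ⊛ 3 ⟧ (toℤ (pqx p q m)) ≡ + (p * m) ℤ.- + (5 * q ^ 3)
  ⟦X⟧ = cong₂ ℤ._-_ (sym (ℤ.pos-* p m)) (trans (cong (ℤ._*_ (+ 5)) (sym (pos-^ q 3))) (sym (ℤ.pos-* 5 (q ^ 3))))

Q-above-N : ∀ {p q m} → Large p q → m ≤ 11 → Q (+ p) (+ q) (⟦ 𝑵 ⊕ 𝑥 ⟧ (toℤ (pqx p q m))) ≡ 0ℤ →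
  ∣ p * m - 5 * q ^ 3 ∣ < 255 * q
Q-above-N {p} {q} {m} large m≤11 Q≡0 = ℕ.*-cancelˡ-< (16 * p ^ 16 * q) (∣ p * m - 5 * q ^ 3 ∣) (255 * q) (begin-strict
  16 * p ^ 16 * q * ∣ p * m - 5 * q ^ 3 ∣                                    ≡⟨ ∣⟦above-N-lead⟧∣ {p} {q} {m} ⟨
  ℤ.∣ ⟦ above-N-lead ⟧ (toℤ (pqx p q m)) ∣                                  ≡⟨ lead≡expansion ⟨
  ℤ.∣ ⟦ expansion above-N ⟧ₘ (toℤ (pqx p q m)) ∣
    <⟨ bounded-dominated 5 16 2 4080 (expansion above-N) {p} {q} {m} {11} large m≤11
         above-N-certified above-N-bound ⟩
  4080 * (p ^ 16 * q ^ 2)                                                     ≡⟨ lemma (p ^ 16) q ⟩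
  16 * p ^ 16 * q * (255 * q)                                                 ∎)
  where
  open ℕ.≤-Reasoning
  lead≡expansion : ℤ.∣ ⟦ expansion above-N ⟧ₘ (toℤ (pqx p q m)) ∣ ≡ ℤ.∣ ⟦ above-N-lead ⟧ (toℤ (pqx p q m)) ∣
  lead≡expansion = expansion-⊖-root {e = above-N} (Qᴱ 𝑝 𝑞 (𝑵 ⊕ 𝑥)) above-N-lead (toℤ (pqx p q m)) refl
    (Q≡0⇒⟦Qᴱ⟧≡0 {p} {q} {m} (𝑵 ⊕ 𝑥) Q≡0)
  lemma : ∀ P q → 4080 * (P * (q * (q * 1))) ≡ 16 * P * q * (255 * q)
  lemma = ℕ-Solver.solve-∀

at-N+5-lead : Expr 3
at-N+5-lead = con (+ 80) ⊗ 𝑝 ⊛ 15 ⊗ 𝑞 ⊗ (𝑝 ⊕ con (+ 10) ⊗ 𝑞) ⊗ (𝑝 ⊖ 𝑞 ⊛ 3 ⊕ con (+ 4) ⊗ 𝑞)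

at-N+5 : Expr 3
at-N+5 = Qᴱ 𝑝 𝑞 (𝑵 ⊕ con (+ 5)) ⊖ at-N+5-lead

at-N+5-certified : Certified ℤ.∣_∣ (DominatedMonomial 16 1) (expansion at-N+5)
at-N+5-certified = toWitness {a? = certified? ℤ.∣_∣ (dominatedMonomial? 16 1) (expansion at-N+5)} _

at-N+5-bound : weightedSum ℤ.∣_∣ (boundedCost 4 16 1 0) (expansion at-N+5) < 80 * 3600 ^ 4
at-N+5-bound = ℕ.≤ᵇ⇒≤ (suc (weightedSum ℤ.∣_∣ (boundedCost 4 16 1 0) (expansion at-N+5))) (80 * 3600 ^ 4) _

∣⟦at-N+5-lead⟧∣ : ∀ {p q} → ℤ.∣ ⟦ at-N+5-lead ⟧ (toℤ (pqx p q 0)) ∣ ≡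
  80 * p ^ 15 * q * (p + 10 * q) * ℤ.∣ ⟦ 𝑝 ⊖ 𝑞 ⊛ 3 ⊕ con (+ 4) ⊗ 𝑞 ⟧ (toℤ (pqx p q 0)) ∣
∣⟦at-N+5-lead⟧∣ {p} {q} = begin
  ℤ.∣ ⟦ con (+ 80) ⊗ 𝑝 ⊛ 15 ⊗ 𝑞 ⟧ ρ ℤ.* ⟦ 𝑝 ⊕ con (+ 10) ⊗ 𝑞 ⟧ ρ ℤ.* k ∣
    ≡⟨ cong₂ (λ u v → ℤ.∣ u ℤ.* v ℤ.* k ∣) (⟦c𝑝ⁱ𝑞⟧ 80 15 {p} {q} {0}) ⟦p+10q⟧ ⟩
  ℤ.∣ + (80 * p ^ 15 * q) ℤ.* + (p + 10 * q) ℤ.* k ∣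
    ≡⟨ cong (λ v → ℤ.∣ v ℤ.* k ∣) (ℤ.pos-* (80 * p ^ 15 * q) (p + 10 * q)) ⟨
  ℤ.∣ + (80 * p ^ 15 * q * (p + 10 * q)) ℤ.* k ∣
    ≡⟨ ℤ.abs-* (+ (80 * p ^ 15 * q * (p + 10 * q))) k ⟩
  80 * p ^ 15 * q * (p + 10 * q) * ℤ.∣ k ∣ ∎
  where
  open ≡-Reasoning
  ρ = toℤ (pqx p q 0)
  k = ⟦ 𝑝 ⊖ 𝑞 ⊛ 3 ⊕ con (+ 4) ⊗ 𝑞 ⟧ ρ
  ⟦p+10q⟧ : ⟦ 𝑝 ⊕ con (+ 10) ⊗ 𝑞 ⟧ ρ ≡ + (p + 10 * q)
  ⟦p+10q⟧ = trans (cong (ℤ._+_ (+ p)) (sym (ℤ.pos-* 10 q))) (sym (ℤ.pos-+ p (10 * q)))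

Q-at-N+5 : ∀ {p q} → Large p q → Q (+ p) (+ q) (⟦ 𝑵 ⊕ con (+ 5) ⟧ (toℤ (pqx p q 0))) ≡ 0ℤ →
  ⟦ 𝑝 ⊖ 𝑞 ⊛ 3 ⊕ con (+ 4) ⊗ 𝑞 ⟧ (toℤ (pqx p q 0)) ≡ 0ℤ
Q-at-N+5 {p} {q} large Q≡0 = ℤ.∣i∣≡0⇒i≡0 (ℕ.n<1⇒n≡0 (ℕ.*-cancelˡ-< L (ℤ.∣ k ∣) 1 (begin-strict
  L * ℤ.∣ k ∣                                           ≡⟨ ∣⟦at-N+5-lead⟧∣ {p} {q} ⟨
  ℤ.∣ ⟦ at-N+5-lead ⟧ (toℤ (pqx p q 0)) ∣               ≡⟨ lead≡expansion ⟨
  ℤ.∣ ⟦ expansion at-N+5 ⟧ₘ (toℤ (pqx p q 0)) ∣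
    <⟨ bounded-dominated 4 16 1 80 (expansion at-N+5) {p} {q} {0} {0} large z≤n at-N+5-certified at-N+5-bound ⟩
  80 * (p ^ 16 * q ^ 1)                                 ≡⟨ lemma (p ^ 15) p q ⟩
  80 * p ^ 15 * q * p                                   ≤⟨ ℕ.*-monoʳ-≤ (80 * p ^ 15 * q) (ℕ.m≤m+n p (10 * q)) ⟩
  80 * p ^ 15 * q * (p + 10 * q)                        ≡⟨ ℕ.*-identityʳ L ⟨
  L * 1                                                 ∎)))
  where
  open ℕ.≤-Reasoning
  L = 80 * p ^ 15 * q * (p + 10 * q)
  k = ⟦ 𝑝 ⊖ 𝑞 ⊛ 3 ⊕ con (+ 4) ⊗ 𝑞 ⟧ (toℤ (pqx p q 0))
  lead≡expansion : ℤ.∣ ⟦ expansion at-N+5 ⟧ₘ (toℤ (pqx p q 0)) ∣ ≡ ℤ.∣ ⟦ at-N+5-lead ⟧ (toℤ (pqx p q 0)) ∣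
  lead≡expansion = expansion-⊖-root {e = at-N+5} (Qᴱ 𝑝 𝑞 (𝑵 ⊕ con (+ 5))) at-N+5-lead (toℤ (pqx p q 0)) refl
    (Q≡0⇒⟦Qᴱ⟧≡0 {p} {q} {0} (𝑵 ⊕ con (+ 5)) Q≡0)
  lemma : ∀ P p q → 80 * (p * P * (q * 1)) ≡ 80 * P * q * p
  lemma = ℕ-Solver.solve-∀

p+4q≡q³ : ∀ {p q x} → ⟦ 𝑝 ⊖ 𝑞 ⊛ 3 ⊕ con (+ 4) ⊗ 𝑞 ⟧ (toℤ (pqx p q x)) ≡ 0ℤ → p + 4 * q ≡ q ^ 3
p+4q≡q³ {p} {q} k≡0 = ⟦⟧ᶻ-injective (‵ p ‵+ ‵ 4 ‵* ‵ q) (‵ q ‵* (‵ q ‵* (‵ q ‵* ‵ 1))) (lemma (+ p) (+ q) k≡0)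
  where
  lemma : ∀ P Q → P ℤ.- Q ℤ.* (Q ℤ.* (Q ℤ.* 1ℤ)) ℤ.+ + 4 ℤ.* Q ≡ 0ℤ → P ℤ.+ + 4 ℤ.* Q ≡ Q ℤ.* (Q ℤ.* (Q ℤ.* 1ℤ))
  lemma P Q k≡0 = begin
    P ℤ.+ + 4 ℤ.* Q                 ≡⟨ split P Q ⟩
    (P ℤ.- Q³ ℤ.+ + 4 ℤ.* Q) ℤ.+ Q³  ≡⟨ cong (ℤ._+ Q³) k≡0 ⟩
    0ℤ ℤ.+ Q³                       ≡⟨ ℤ.+-identityˡ Q³ ⟩
    Q³                              ∎
    where
    open ≡-Reasoning
    Q³ = Q ℤ.* (Q ℤ.* (Q ℤ.* 1ℤ))
    split : ∀ P Q → P ℤ.+ + 4 ℤ.* Q ≡ P ℤ.- Q ℤ.* (Q ℤ.* (Q ℤ.* 1ℤ)) ℤ.+ + 4 ℤ.* Q ℤ.+ Q ℤ.* (Q ℤ.* (Q ℤ.* 1ℤ))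
    split = solve-∀

m≤n+o⇒n≤m+o⇒∣m-n∣≤o : ∀ {m n o} → m ≤ n + o → n ≤ m + o → ∣ m - n ∣ ≤ o
m≤n+o⇒n≤m+o⇒∣m-n∣≤o {m} {n} {o} m≤n+o n≤m+o with ℕ.≤-total m n
... | inj₁ m≤n = ℕ.≤-trans (ℕ.≤-reflexive (ℕ.m≤n⇒∣m-n∣≡n∸m m≤n)) (ℕ.m≤n+o⇒m∸n≤o n m n≤m+o)
... | inj₂ n≤m = ℕ.≤-trans (ℕ.≤-reflexive (ℕ.m≤n⇒∣n-m∣≡n∸m n≤m)) (ℕ.m≤n+o⇒m∸n≤o m n m≤n+o)

near-multiple : ∀ {K B c x} → (B * K ∸ 1) * c ≤ K * x → K * x ≤ (B * K + 1) * c → ∣ K * x - B * K * c ∣ ≤ c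
near-multiple {K} {B} {c} {x} lo hi = m≤n+o⇒n≤m+o⇒∣m-n∣≤o hi′ lo′
  where
  open ℕ.≤-Reasoning
  hi′ : K * x ≤ B * K * c + c
  hi′ = ℕ.≤-trans hi (ℕ.≤-reflexive (trans (ℕ.*-distribʳ-+ c (B * K) 1) (cong (_+_ (B * K * c)) (ℕ.*-identityˡ c))))
  lo′ : B * K * c ≤ K * x + c
  lo′ = begin
    B * K * c                 ≤⟨ ℕ.m≤n+m∸n (B * K * c) c ⟩
    c + (B * K * c ∸ c)       ≡⟨ cong (_+_ c) (trans (ℕ.*-distribʳ-∸ c (B * K) 1) (cong (B * K * c ∸_) (ℕ.*-identityˡ c))) ⟨
    c + (B * K ∸ 1) * c       ≤⟨ ℕ.+-monoʳ-≤ c lo ⟩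
    c + K * x                 ≡⟨ ℕ.+-comm c (K * x) ⟩
    K * x + c                 ∎

near-multiple⇒≡ : ∀ {K B c x} → c < K → ∣ K * x - B * K * c ∣ ≤ c → x ≡ B * c
near-multiple⇒≡ {K} {B} {c} {x} c<K near = ℕ.∣m-n∣≡0⇒m≡n (ℕ.n<1⇒n≡0 (ℕ.*-cancelˡ-< K _ 1 (begin-strict
  K * ∣ x - B * c ∣        ≡⟨ ℕ.*-distribˡ-∣-∣ K x (B * c) ⟩
  ∣ K * x - K * (B * c) ∣  ≡⟨ cong (λ v → ∣ K * x - v ∣) (lemma K B c) ⟩
  ∣ K * x - B * K * c ∣    ≤⟨ near ⟩
  c                        <⟨ c<K ⟩
  K                        ≡⟨ ℕ.*-identityʳ K ⟨
  K * 1                    ∎)))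
  where
  open ℕ.≤-Reasoning
  lemma : ∀ K B c → K * (B * c) ≡ B * K * c
  lemma = ℕ-Solver.solve-∀

near-multiple⇒≤2x : ∀ {K B c x} → 2 ≤ K → 1 ≤ B → ∣ K * x - B * K * c ∣ ≤ c → c ≤ 2 * x
near-multiple⇒≤2x {K} {B} {c} {x} 2≤K 1≤B near = ℕ.*-cancelˡ-≤ K {{>-nonZero (ℕ.<-≤-trans (s≤s z≤n) 2≤K)}}
  (ℕ.+-cancelʳ-≤ (K * c) (K * c) (K * (2 * x)) (begin
    K * c + K * c           ≤⟨ ℕ.+-mono-≤ Kc≤Kx+c Kc≤Kx+c ⟩
    K * x + c + (K * x + c) ≡⟨ lemma K x c ⟩
    K * (2 * x) + 2 * c     ≤⟨ ℕ.+-monoʳ-≤ (K * (2 * x)) (ℕ.*-monoˡ-≤ c 2≤K) ⟩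
    K * (2 * x) + K * c     ∎))
  where
  open ℕ.≤-Reasoning
  lemma : ∀ K x c → K * x + c + (K * x + c) ≡ K * (2 * x) + 2 * c
  lemma = ℕ-Solver.solve-∀
  Kc≤Kx+c : K * c ≤ K * x + c
  Kc≤Kx+c = begin
    K * c                       ≤⟨ ℕ.*-monoˡ-≤ c (ℕ.m≤n*m K B {{>-nonZero 1≤B}}) ⟩
    B * K * c                   ≤⟨ ℕ.m≤n+∣m-n∣ (B * K * c) (K * x) ⟩
    K * x + ∣ B * K * c - K * x ∣ ≡⟨ cong (_+_ (K * x)) (ℕ.∣-∣-comm (B * K * c) (K * x)) ⟩
    K * x + ∣ K * x - B * K * c ∣ ≤⟨ ℕ.+-monoʳ-≤ (K * x) near ⟩
    K * x + c                   ∎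

cube-dominates : ∀ {K q} → 22 < K → 3600 ≤ q → 11 * q ^ 3 + K * (255 * q) < K * q ^ 3
cube-dominates {K} {q} 22<K 3600≤q = ℕ.*-cancelˡ-< 2 _ _ (begin-strict
  2 * (11 * q ^ 3 + K * (255 * q)) ≡⟨ lemma₁ K q (q ^ 3) ⟩
  22 * q ^ 3 + K * (510 * q)       <⟨ ℕ.+-mono-<-≤ (ℕ.*-monoˡ-< (q ^ 3) {{ℕ.m^n≢0 q 3 {{q≢0}}}} 22<K)
                                                     (ℕ.*-monoʳ-≤ K 510q≤q³) ⟩
  K * q ^ 3 + K * q ^ 3            ≡⟨ lemma₂ K (q ^ 3) ⟩
  2 * (K * q ^ 3)                  ∎)
  where
  open ℕ.≤-Reasoning
  q≢0 : NonZero q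
  q≢0 = >-nonZero (ℕ.<-≤-trans (s≤s z≤n) 3600≤q)
  lemma₁ : ∀ a b c → 2 * (11 * c + a * (255 * b)) ≡ 22 * c + a * (510 * b)
  lemma₁ = ℕ-Solver.solve-∀
  lemma₂ : ∀ a b → a * b + a * b ≡ 2 * (a * b)
  lemma₂ = ℕ-Solver.solve-∀
  510q≤q³ : 510 * q ≤ q ^ 3
  510q≤q³ = begin
    510 * q           ≤⟨ ℕ.*-monoˡ-≤ q (ℕ.≤-trans (ℕ.≤ᵇ⇒≤ 510 3600 _) (ℕ.≤-trans 3600≤q (ℕ.m≤m*n q q {{q≢0}}))) ⟩
    q * q * q         ≡⟨ lemma₃ q ⟩
    q ^ 3             ∎
    where
    lemma₃ : ∀ a → a * a * a ≡ a * (a * (a * 1))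
    lemma₃ = ℕ-Solver.solve-∀

-- Multiplying |pm − 5q³| < 255q by K and comparing with |Kp − BKq³| ≤ q³ leaves |mB − 5| Kq³ < Kq³.
excess*B≡5 : ∀ {K B p q m} → 22 < K → 3600 ≤ q → m ≤ 11 → ∣ K * p - B * K * q ^ 3 ∣ ≤ q ^ 3 →
  ∣ p * m - 5 * q ^ 3 ∣ < 255 * q → m * B ≡ 5
excess*B≡5 {K} {B} {p} {q} {m} 22<K 3600≤q m≤11 near close = ℕ.∣m-n∣≡0⇒m≡n (ℕ.n<1⇒n≡0
  (ℕ.*-cancelʳ-< (K * c) ∣ m * B - 5 ∣ 1 (begin-strict
    ∣ m * B - 5 ∣ * (K * c)
      ≡⟨ ℕ.*-distribʳ-∣-∣ (K * c) (m * B) 5 ⟩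
    ∣ m * B * (K * c) - 5 * (K * c) ∣
      ≤⟨ ℕ.∣-∣-triangle (m * B * (K * c)) (m * (K * p)) (5 * (K * c)) ⟩
    ∣ m * B * (K * c) - m * (K * p) ∣ + ∣ m * (K * p) - 5 * (K * c) ∣
      ≡⟨ cong₂ _+_ (trans (cong (λ v → ∣ v - m * (K * p) ∣) (lemma₁ m B K c)) (sym (ℕ.*-distribˡ-∣-∣ m (B * K * c) (K * p))))
                   (trans (cong₂ ∣_-_∣ (lemma₂ m K p) (lemma₃ K c)) (sym (ℕ.*-distribˡ-∣-∣ K (p * m) (5 * c)))) ⟩
    m * ∣ B * K * c - K * p ∣ + K * ∣ p * m - 5 * c ∣
      ≤⟨ ℕ.+-mono-≤ (ℕ.*-mono-≤ m≤11 (ℕ.≤-trans (ℕ.≤-reflexive (ℕ.∣-∣-comm (B * K * c) (K * p))) near))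
                    (ℕ.*-monoʳ-≤ K (ℕ.<⇒≤ close)) ⟩
    11 * c + K * (255 * q)
      <⟨ cube-dominates 22<K 3600≤q ⟩
    K * c
      ≡⟨ ℕ.*-identityˡ (K * c) ⟨
    1 * (K * c) ∎)))
  where
  open ℕ.≤-Reasoning
  c = q ^ 3
  lemma₁ : ∀ a b d e → a * b * (d * e) ≡ a * (b * d * e)
  lemma₁ = ℕ-Solver.solve-∀
  lemma₂ : ∀ a b d → a * (b * d) ≡ b * (d * a)
  lemma₂ = ℕ-Solver.solve-∀
  lemma₃ : ∀ a b → 5 * (a * b) ≡ a * (5 * b)
  lemma₃ = ℕ-Solver.solve-∀

m*B≡5⇒m≡5 : ∀ {m B} → m * B ≡ 5 → B ≢ 5 → m ≡ 5
m*B≡5⇒m≡5 {m} {B} m*B≡5 B≢5 with prime⇒irreducible (toWitness {a? = prime? 5} _) (divides m (sym m*B≡5))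
... | inj₁ B≡1 = trans (sym (ℕ.*-identityʳ m)) (trans (cong (m *_) (sym B≡1)) m*B≡5)
... | inj₂ B≡5 = contradiction B≡5 B≢5

p+4q≡q³⇒q∣p : ∀ {p q} → p + 4 * q ≡ q ^ 3 → q ∣ p
p+4q≡q³⇒q∣p {p} {q} eq = ∣m+n∣m⇒∣n (subst (q ∣_) (trans (sym eq) (ℕ.+-comm p (4 * q))) (m∣m*n (q ^ 2))) (n∣m*n 4)

t<100 : ∀ {p t} → p ≤ 9 → 2 * t ^ 2 < (p ^ 2 + t) * (p * 1 + t) → t < 100
t<100 {p} {t} p≤9 cuboid with 100 ≤? t
... | no t≱100 = ℕ.≰⇒> t≱100
... | yes 100≤t = contradiction cuboid (ℕ.≤⇒≯ (begin
  (p ^ 2 + t) * (p * 1 + t)               ≤⟨ ℕ.*-mono-≤ (ℕ.+-monoˡ-≤ t (ℕ.*-mono-≤ p≤9 (ℕ.*-monoˡ-≤ 1 p≤9)))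
                                                        (ℕ.+-monoˡ-≤ t (ℕ.*-monoˡ-≤ 1 p≤9)) ⟩
  (81 + t) * (9 + t)                       ≡⟨ cong (λ v → (81 + v) * (9 + v)) t≡100+u ⟩
  (181 + u) * (109 + u)                    ≤⟨ ℕ.m≤m+n _ (271 + 110 * u + u * u) ⟩
  (181 + u) * (109 + u) + (271 + 110 * u + u * u) ≡⟨ lemma u ⟩
  2 * (100 + u) ^ 2                        ≡⟨ cong (λ v → 2 * v ^ 2) t≡100+u ⟨
  2 * t ^ 2                                ∎))
  where
  open ℕ.≤-Reasoning
  u = t ∸ 100
  t≡100+u : t ≡ 100 + u
  t≡100+u = sym (ℕ.m+[n∸m]≡n 100≤t)
  lemma : ∀ u → (181 + u) * (109 + u) + (271 + 110 * u + u * u) ≡ 2 * ((100 + u) * ((100 + u) * 1))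
  lemma = ℕ-Solver.solve-∀

no-root-at-q≡1-table : ∀ (i : Fin 8) (j : Fin 100) → Q (+ (2 + toℕ i)) (+ 1) (+ toℕ j) ≢ 0ℤ
no-root-at-q≡1-table = toWitness {a? = Fin.all? (λ i → Fin.all? (λ j → ¬? (Q (+ (2 + toℕ i)) (+ 1) (+ toℕ j) ℤ.≟ 0ℤ)))} _

no-root-at-q≡1 : ∀ {p t} → 2 ≤ p → p ≤ 9 → t < 100 → Q (+ p) (+ 1) (+ t) ≢ 0ℤ
no-root-at-q≡1 {p} {t} 2≤p p≤9 t<100 =
  subst₂ (λ a b → Q (+ a) (+ 1) (+ b) ≢ 0ℤ) p≡ (Fin.toℕ-fromℕ< t<100) (no-root-at-q≡1-table (fromℕ< p-2<8) (fromℕ< t<100))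
  where
  p-2<8 : p ∸ 2 < 8
  p-2<8 = ℕ.∸-monoˡ-< {p} {2} {10} (s≤s p≤9) 2≤p
  p≡ : 2 + toℕ (fromℕ< p-2<8) ≡ p
  p≡ = trans (cong (_+_ 2) (Fin.toℕ-fromℕ< p-2<8)) (ℕ.m+[n∸m]≡n 2≤p)

large-root⇒q∣p : ∀ {B p q t} → Large p q → B ≢ 5 → ∣ 3600 ^ 3 * p - B * 3600 ^ 3 * q ^ 3 ∣ ≤ q ^ 3 →
  Q (+ p) (+ q) (+ t) ≡ 0ℤ → p ^ 2 < t → 2 * t ^ 2 < (p ^ 2 + t) * (p * q + t) → q ∣ p
large-root⇒q∣p {B} {p} {q} {t} large B≢5 near Q≡0 p²<t cuboid =
  [ (λ below → contradiction (root-below below) (Q-below-N≢0 {p} {q} {n} large (ℕ.m<n⇒0<n∸m below) (n≤2pq below)))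
  , (λ above → p+4q≡q³⇒q∣p (p+4q≡q³ {p} {q} {0} (Q-at-N+5 {p} {q} large (root-at-N+5 above))))
  ]′ (ℕ.<-≤-connex (t + 2 * q ^ 2) (p ^ 2 + 2 * p * q))
  where
  open Large large
  n = p ^ 2 + 2 * p * q ∸ (t + 2 * q ^ 2)
  m = t + 2 * q ^ 2 ∸ (p ^ 2 + 2 * p * q)
  root-at : ∀ {τ} → + t ≡ τ → Q (+ p) (+ q) τ ≡ 0ℤ
  root-at t≡τ = subst (λ τ → Q (+ p) (+ q) τ ≡ 0ℤ) t≡τ Q≡0
  root-below : t + 2 * q ^ 2 < p ^ 2 + 2 * p * q → Q (+ p) (+ q) (⟦ 𝑵 ⊖ 𝑥 ⟧ (toℤ (pqx p q n))) ≡ 0ℤ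
  root-below below = root-at (shift-below {p} {q} {t} {n} (ℕ.m+[n∸m]≡n (ℕ.<⇒≤ below)))
  n≤2pq : t + 2 * q ^ 2 < p ^ 2 + 2 * p * q → n ≤ 2 * p * q
  n≤2pq below = ℕ.+-cancelˡ-≤ (p ^ 2) n (2 * p * q) (begin
    p ^ 2 + n                 ≤⟨ ℕ.+-monoˡ-≤ n (ℕ.≤-trans (ℕ.<⇒≤ p²<t) (ℕ.m≤m+n t (2 * q ^ 2))) ⟩
    t + 2 * q ^ 2 + n         ≡⟨ ℕ.m+[n∸m]≡n (ℕ.<⇒≤ below) ⟩
    p ^ 2 + 2 * p * q         ∎)
    where open ℕ.≤-Reasoning
  t≡N+m : p ^ 2 + 2 * p * q ≤ t + 2 * q ^ 2 → + t ≡ ⟦ 𝑵 ⊕ 𝑥 ⟧ (toℤ (pqx p q m))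
  t≡N+m above = shift-above {p} {q} {t} {m} (sym (ℕ.m+[n∸m]≡n above))
  m≡5 : p ^ 2 + 2 * p * q ≤ t + 2 * q ^ 2 → m ≡ 5
  m≡5 above = m*B≡5⇒m≡5 (excess*B≡5 {3600 ^ 3} {B} {p} {q} {m} (ℕ.≤ᵇ⇒≤ 23 (3600 ^ 3) _) 3600≤q m≤11 near
    (Q-above-N {p} {q} {m} large m≤11 (root-at (t≡N+m above)))) B≢5
    where
    m≤11 : m ≤ 11
    m≤11 = excess≤11 {p} {q} {t} {m} large (t≡N+m above) cuboid
  root-at-N+5 : p ^ 2 + 2 * p * q ≤ t + 2 * q ^ 2 → Q (+ p) (+ q) (⟦ 𝑵 ⊕ con (+ 5) ⟧ (toℤ (pqx p q 0))) ≡ 0ℤ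
  root-at-N+5 above = root-at (trans (t≡N+m above) (cong (λ v → ⟦ 𝑵 ⊕ 𝑥 ⟧ (toℤ (pqx p q v))) (m≡5 above)))

small-root⇒⊥ : ∀ {B p q t} → q < 3600 → B ≤ 9 → 0 < p → p ≢ q → Coprime p q →
  ∣ 3600 ^ 3 * p - B * 3600 ^ 3 * q ^ 3 ∣ ≤ q ^ 3 → Q (+ p) (+ q) (+ t) ≡ 0ℤ →
  2 * t ^ 2 < (p ^ 2 + t) * (p * q + t) → ⊥
small-root⇒⊥ {B} {p} {q} {t} q<3600 B≤9 0<p p≢q coprime near Q≡0 cuboid =
  no-root-at-q≡1 2≤p p≤9 (t<100 p≤9 (subst (λ v → 2 * t ^ 2 < (p ^ 2 + t) * (p * v + t)) q≡1 cuboid))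
    (subst (λ v → Q (+ p) (+ v) (+ t) ≡ 0ℤ) q≡1 Q≡0)
  where
  p≡Bq³ : p ≡ B * q ^ 3
  p≡Bq³ = near-multiple⇒≡ {3600 ^ 3} {B} {q ^ 3} {p} (ℕ.^-monoˡ-< 3 q<3600) near
  q≡1 : q ≡ 1
  q≡1 = coprime (divides (B * q ^ 2) (trans p≡Bq³ (lemma B q)) , ∣-refl)
    where
    lemma : ∀ B q → B * (q * (q * (q * 1))) ≡ B * (q * (q * 1)) * q
    lemma = ℕ-Solver.solve-∀
  p≤9 : p ≤ 9
  p≤9 = ℕ.≤-trans (ℕ.≤-reflexive (trans p≡Bq³ (trans (cong (λ v → B * v ^ 3) q≡1) (ℕ.*-identityʳ B)))) B≤9
  2≤p : 2 ≤ p
  2≤p = ℕ.≤∧≢⇒< 0<p (λ 1≡p → p≢q (trans (sym 1≡p) (sym q≡1)))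

theorem9p1 : (B p q : ℕ) → 1 ≤ B → B ≤ 9 → B ≢ 5 →
    0 < p → 0 < q → p ≢ q → Coprime p q →
    (B * 3600 ^ 3 ∸ 1) * q ^ 3 ≤ 3600 ^ 3 * p →
    3600 ^ 3 * p ≤ (B * 3600 ^ 3 + 1) * q ^ 3 →
    (t : ℕ) → 0 < t → ¬ ProducesPerfectCuboid p q t
theorem9p1 B p q 1≤B B≤9 B≢5 0<p _ p≢q coprime lo hi t _ (_ , _ , _ , _ , _ , Q≡0 , p²<t , _ , _ , cuboid) =
  [ (λ q<3600 → small-root⇒⊥ q<3600 B≤9 0<p p≢q coprime near Q≡0 cuboid)
  , (λ 3600≤q → ℕ.<⇒≢ (ℕ.<-≤-trans (s≤s (s≤s z≤n)) 3600≤q) (sym (q≡1 3600≤q)))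
  ]′ (ℕ.<-≤-connex q 3600)
  where
  near : ∣ 3600 ^ 3 * p - B * 3600 ^ 3 * q ^ 3 ∣ ≤ q ^ 3
  near = near-multiple {3600 ^ 3} {B} {q ^ 3} {p} lo hi
  q≡1 : 3600 ≤ q → q ≡ 1
  q≡1 3600≤q = coprime (large-root⇒q∣p large B≢5 near Q≡0 p²<t cuboid , ∣-refl)
    where
    large : Large p q
    large = record
      { 3600≤q = 3600≤q
      ; q³≤2p = near-multiple⇒≤2x {3600 ^ 3} {B} {q ^ 3} {p} (ℕ.≤ᵇ⇒≤ 2 (3600 ^ 3) _) 1≤B near
      }
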